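{- For any monoidal signature $\Sigma$, the ordered prop $\mathbb{CB}_{\Sigma}$ is a cartesian bicategory.
   Context: A monoidal signature $\Sigma$ is a set of symbols each with an arity $n$ and coarity $m$ ($\Sigma_{n,m}$ those with arity $n$, coarity $m$). GCQ terms with sorts $(n,m)$ are generated by constants $\delta:(1,2)$, $\varepsilon:(1,0)$, $\mu:(2,1)$, $\eta:(0,1)$, $\mathrm{id}_0:(0,0)$, $\mathrm{id}_1:(1,1)$, $\sigma:(2,2)$, symbols $R\in\Sigma_{n,m}$ of sort $(n,m)$, $c;d$ (sorts $(n,z),(z,m)\mapsto(n,m)$) and $c\oplus d$ (sorts $(n,m),(p,q)\mapsto(n+p,m+q)$). Write $\mathrm{id}_n$ for the $n$-fold $\oplus$ of $\mathrm{id}_1$, $\sigma_{n,m}$ for symmetries built from $\sigma$, $\varepsilon_0=\mathrm{id}_0$, $\varepsilon_{n+1}=\varepsilon\oplus\varepsilon_n$, $\delta_0=\mathrm{id}_0$, $\delta_{n+1}=(\delta\oplus\delta_n);(\mathrm{id}_1\oplus\sigma_{1,n}\oplus\mathrm{id}_n)$. Equations (E): strict symmetric monoidal category laws with symmetry generated by $\sigma$; $\delta;(\delta\oplus\mathrm{id}_1)=\delta;(\mathrm{id}_1\oplus\delta)$, $\delta;(\varepsilon\oplus\mathrm{id}_1)=\mathrm{id}_1$, $\delta;\sigma=\delta$; $(\mu\oplus\mathrm{id}_1);\mu=(\mathrm{id}_1\oplus\mu);\mu$, $(\eta\oplus\mathrm{id}_1);\mu=\mathrm{id}_1$, $\sigma;\mu=\mu$;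 $(\delta\oplus\mathrm{id}_1);(\mathrm{id}_1\oplus\mu)=\mu;\delta=(\mathrm{id}_1\oplus\delta);(\mu\oplus\mathrm{id}_1)$; $\delta;\mu=\mathrm{id}_1$. Inequalities (I): $\mathrm{id}_1\le\varepsilon;\eta$, $\eta;\varepsilon\le\mathrm{id}_0$, $\mathrm{id}_1\le\delta;\mu$, $\mu;\delta\le\mathrm{id}_2$, and for each $R\in\Sigma_{n,m}$: $R;\delta_m\le\delta_n;(R\oplus R)$, $R;\varepsilon_m\le\varepsilon_n$. Let $\le_{\mathbb{CB}}$ be the smallest precongruence (preorder compatible with $;$ and $\oplus$) on terms generated by (E) (each read as two inequalities) and (I). The ordered prop $\mathbb{CB}_\Sigma$ has objects natural numbers, arrows $n\to m$ the terms of sort $(n,m)$ modulo $\le_{\mathbb{CB}}\cap\ge_{\mathbb{CB}}$, partially ordered by $\le_{\mathbb{CB}}$. A cartesian bicategory is a symmetric monoidal category $(\mathcal B,\oplus,I)$ enriched over partially ordered sets such that each object $X$ carries a monoid $\mu_X,\eta_X$ and comonoid $\delta_X,\varepsilon_X$ forming a special commutative Frobenius bimonoid (laws as (E) above with $X$ in place of $1$), adjoint in the sense $\mathrm{id}_X\le\varepsilon_X;\eta_X$, $\eta_X;\varepsilon_X\le\mathrm{id}_I$, $\mathrm{id}_X\le\delta_X;\mu_X$, $\mu_X;\delta_X\le\mathrm{id}_{X\oplus X}$, and such that every arrow $R:X\to Y$ satisfies $R;\delta_Y\le\delta_X;(R\oplus R)$ and $R;\varepsilon_Y\le\varepsilon_X$.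 -}

module Defs where

open import Data.Nat using (ℕ; zero; suc; _+_)
open import Data.Nat.Properties using (+-assoc; +-identityʳ)
open import Data.Product using (_×_; _,_)
open import Relation.Binary.PropositionalEquality using (_≡_; refl; sym; cong)

-- Hom-sets carry a preorder _≤_; equality of arrows is the induced
-- equivalence  f ≈ g  :=  f ≤ g × g ≤ f  (so the hom-poset is the
-- quotient by ≈; Agda has no quotient types).

record OrderedSMC : Set₁ where
  infixr 9 _⨾_
  infixr 10 _⊗₀_ _⊗₁_
  infix 4 _≤_
  field
    Obj  : Set
    Hom  : Obj → Obj → Set
    _≤_  : ∀ {X Y} → Hom X Y → Hom X Y → Set
    id   : ∀ X → Hom X X
    _⨾_  : ∀ {X Y Z} → Hom X Y → Hom Y Z → Hom X Z
    𝟙    : Obj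
    _⊗₀_ : Obj → Obj → Obj
    _⊗₁_ : ∀ {X Y X' Y'} → Hom X Y → Hom X' Y' → Hom (X ⊗₀ X') (Y ⊗₀ Y')
    α    : ∀ X Y Z → Hom ((X ⊗₀ Y) ⊗₀ Z) (X ⊗₀ (Y ⊗₀ Z))
    α⁻   : ∀ X Y Z → Hom (X ⊗₀ (Y ⊗₀ Z)) ((X ⊗₀ Y) ⊗₀ Z)
    lu   : ∀ X → Hom (𝟙 ⊗₀ X) X
    lu⁻  : ∀ X → Hom X (𝟙 ⊗₀ X)
    ru   : ∀ X → Hom (X ⊗₀ 𝟙) X
    ru⁻  : ∀ X → Hom X (X ⊗₀ 𝟙)
    σ    : ∀ X Y → Hom (X ⊗₀ Y) (Y ⊗₀ X)

module _ (C : OrderedSMC) where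
  open OrderedSMC C

  infix 4 _≈_
  _≈_ : ∀ {X Y} → Hom X Y → Hom X Y → Set
  f ≈ g = (f ≤ g) × (g ≤ f)

  record IsCartesianBicategory : Set where
    field
      ≤-refl   : ∀ {X Y} (f : Hom X Y) → f ≤ f
      ≤-trans  : ∀ {X Y} {f g h : Hom X Y} → f ≤ g → g ≤ h → f ≤ h
      ⨾-mono   : ∀ {X Y Z} {f f' : Hom X Y} {g g' : Hom Y Z} →
                 f ≤ f' → g ≤ g' → f ⨾ g ≤ f' ⨾ g'
      ⊗-mono   : ∀ {X Y X' Y'} {f g : Hom X Y} {f' g' : Hom X' Y'} →
                 f ≤ g → f' ≤ g' → f ⊗₁ f' ≤ g ⊗₁ g'
      idˡ      : ∀ {X Y} (f : Hom X Y) → id X ⨾ f ≈ f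
      idʳ      : ∀ {X Y} (f : Hom X Y) → f ⨾ id Y ≈ f
      assoc    : ∀ {W X Y Z} (f : Hom W X) (g : Hom X Y) (h : Hom Y Z) →
                 (f ⨾ g) ⨾ h ≈ f ⨾ (g ⨾ h)
      ⊗-id     : ∀ X Y → id X ⊗₁ id Y ≈ id (X ⊗₀ Y)
      ⊗-⨾      : ∀ {X Y Z X' Y' Z'} (f : Hom X Y) (g : Hom Y Z)
                 (f' : Hom X' Y') (g' : Hom Y' Z') →
                 (f ⨾ g) ⊗₁ (f' ⨾ g') ≈ (f ⊗₁ f') ⨾ (g ⊗₁ g')
      α-iso₁   : ∀ X Y Z → α X Y Z ⨾ α⁻ X Y Z ≈ id ((X ⊗₀ Y) ⊗₀ Z)
      α-iso₂   : ∀ X Y Z → α⁻ X Y Z ⨾ α X Y Z ≈ id (X ⊗₀ (Y ⊗₀ Z))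
      α-nat    : ∀ {X Y Z X' Y' Z'} (f : Hom X X') (g : Hom Y Y') (h : Hom Z Z') →
                 ((f ⊗₁ g) ⊗₁ h) ⨾ α X' Y' Z' ≈ α X Y Z ⨾ (f ⊗₁ (g ⊗₁ h))
      lu-iso₁  : ∀ X → lu X ⨾ lu⁻ X ≈ id (𝟙 ⊗₀ X)
      lu-iso₂  : ∀ X → lu⁻ X ⨾ lu X ≈ id X
      lu-nat   : ∀ {X Y} (f : Hom X Y) → (id 𝟙 ⊗₁ f) ⨾ lu Y ≈ lu X ⨾ f
      ru-iso₁  : ∀ X → ru X ⨾ ru⁻ X ≈ id (X ⊗₀ 𝟙)
      ru-iso₂  : ∀ X → ru⁻ X ⨾ ru X ≈ id X
      ru-nat   : ∀ {X Y} (f : Hom X Y) → (f ⊗₁ id 𝟙) ⨾ ru Y ≈ ru X ⨾ f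
      pentagon : ∀ W X Y Z →
                 (α W X Y ⊗₁ id Z) ⨾ α W (X ⊗₀ Y) Z ⨾ (id W ⊗₁ α X Y Z)
                   ≈ α (W ⊗₀ X) Y Z ⨾ α W X (Y ⊗₀ Z)
      triangle : ∀ X Y → α X 𝟙 Y ⨾ (id X ⊗₁ lu Y) ≈ ru X ⊗₁ id Y
      σ-nat    : ∀ {X Y X' Y'} (f : Hom X X') (g : Hom Y Y') →
                 (f ⊗₁ g) ⨾ σ X' Y' ≈ σ X Y ⨾ (g ⊗₁ f)
      σ-inv    : ∀ X Y → σ X Y ⨾ σ Y X ≈ id (X ⊗₀ Y)
      hexagon  : ∀ X Y Z →
                 α X Y Z ⨾ σ X (Y ⊗₀ Z) ⨾ α Y Z X
                   ≈ (σ X Y ⊗₁ id Z) ⨾ α Y X Z ⨾ (id Y ⊗₁ σ X Z)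
      δ        : ∀ X → Hom X (X ⊗₀ X)
      ε        : ∀ X → Hom X 𝟙
      μ        : ∀ X → Hom (X ⊗₀ X) X
      η        : ∀ X → Hom 𝟙 X
      δ-assoc  : ∀ X → δ X ⨾ (δ X ⊗₁ id X) ⨾ α X X X ≈ δ X ⨾ (id X ⊗₁ δ X)
      δ-unit   : ∀ X → δ X ⨾ (ε X ⊗₁ id X) ⨾ lu X ≈ id X
      δ-comm   : ∀ X → δ X ⨾ σ X X ≈ δ X
      μ-assoc  : ∀ X → (μ X ⊗₁ id X) ⨾ μ X ≈ α X X X ⨾ (id X ⊗₁ μ X) ⨾ μ X
      μ-unit   : ∀ X → (η X ⊗₁ id X) ⨾ μ X ≈ lu X
      μ-comm   : ∀ X → σ X X ⨾ μ X ≈ μ X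
      frob₁    : ∀ X → (δ X ⊗₁ id X) ⨾ α X X X ⨾ (id X ⊗₁ μ X) ≈ μ X ⨾ δ X
      frob₂    : ∀ X → μ X ⨾ δ X ≈ (id X ⊗₁ δ X) ⨾ α⁻ X X X ⨾ (μ X ⊗₁ id X)
      special  : ∀ X → δ X ⨾ μ X ≈ id X
      adj-ε₁   : ∀ X → id X ≤ ε X ⨾ η X
      adj-ε₂   : ∀ X → η X ⨾ ε X ≤ id 𝟙
      adj-δ₁   : ∀ X → id X ≤ δ X ⨾ μ X
      adj-δ₂   : ∀ X → μ X ⨾ δ X ≤ id (X ⊗₀ X)
      lax-δ    : ∀ {X Y} (R : Hom X Y) → R ⨾ δ Y ≤ δ X ⨾ (R ⊗₁ R)
      lax-ε    : ∀ {X Y} (R : Hom X Y) → R ⨾ ε Y ≤ ε X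

record Signature : Set₁ where
  field
    Sym : ℕ → ℕ → Set      -- Sym n m = symbols of arity n, coarity m

infixr 9 _⨾_
infixr 10 _⊕_

data Term (S : Signature) : ℕ → ℕ → Set where
  δ   : Term S 1 2
  ε   : Term S 1 0
  μ   : Term S 2 1
  η   : Term S 0 1
  id₀ : Term S 0 0
  id₁ : Term S 1 1
  σ   : Term S 2 2
  gen : ∀ {n m} → Signature.Sym S n m → Term S n m
  _⨾_ : ∀ {n z m} → Term S n z → Term S z m → Term S n m
  _⊕_ : ∀ {n m p q} → Term S n m → Term S p q → Term S (n + p) (m + q)

module _ {S : Signature} where

  cast : ∀ {n n' m m'} → n ≡ n' → m ≡ m' → Term S n m → Term S n' m'
  cast refl refl t = t

  idₙ : ∀ n → Term S n n
  idₙ zero    = id₀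
  idₙ (suc n) = id₁ ⊕ idₙ n

  σ₁ₙ : ∀ n → Term S (1 + n) (n + 1)
  σ₁ₙ zero    = id₁
  σ₁ₙ (suc n) = (σ ⊕ idₙ n) ⨾ (id₁ ⊕ σ₁ₙ n)

  σₙₘ : ∀ n m → Term S (n + m) (m + n)
  σₙₘ zero    m = cast refl (sym (+-identityʳ m)) (idₙ m)
  σₙₘ (suc n) m = (id₁ ⊕ σₙₘ n m) ⨾ cast refl (+-assoc m 1 n) (σ₁ₙ m ⊕ idₙ n)

  εₙ : ∀ n → Term S n 0
  εₙ zero    = id₀
  εₙ (suc n) = ε ⊕ εₙ n

  δₙ : ∀ n → Term S n (n + n)
  δₙ zero    = id₀
  δₙ (suc n) = cast refl (cong suc (+-assoc n 1 n))
                 ((δ ⊕ δₙ n) ⨾ (id₁ ⊕ (σ₁ₙ n ⊕ idₙ n)))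

  data AxE : ∀ {n m} → Term S n m → Term S n m → Set where
    ⨾-assoc : ∀ {n z w m} (c : Term S n z) (d : Term S z w) (e : Term S w m) →
              AxE ((c ⨾ d) ⨾ e) (c ⨾ (d ⨾ e))
    ⨾-idˡ   : ∀ {n m} (c : Term S n m) → AxE (idₙ n ⨾ c) c
    ⨾-idʳ   : ∀ {n m} (c : Term S n m) → AxE (c ⨾ idₙ m) c
    ⊕-assoc : ∀ {n m p q r s} (c : Term S n m) (d : Term S p q) (e : Term S r s) →
              AxE (cast (+-assoc n p r) (+-assoc m q s) ((c ⊕ d) ⊕ e)) (c ⊕ (d ⊕ e))
    ⊕-unitˡ : ∀ {n m} (c : Term S n m) → AxE (id₀ ⊕ c) c
    ⊕-unitʳ : ∀ {n m} (c : Term S n m) →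
              AxE (cast (+-identityʳ n) (+-identityʳ m) (c ⊕ id₀)) c
    ⊕-id    : ∀ n m → AxE (idₙ n ⊕ idₙ m) (idₙ (n + m))
    interch : ∀ {n z m p w q} (c : Term S n z) (d : Term S z m)
              (c' : Term S p w) (d' : Term S w q) →
              AxE ((c ⨾ d) ⊕ (c' ⨾ d')) ((c ⊕ c') ⨾ (d ⊕ d'))
    σ-inv   : AxE (σ ⨾ σ) (idₙ 2)
    σ-nat   : ∀ {n m p q} (c : Term S n m) (d : Term S p q) →
              AxE ((c ⊕ d) ⨾ σₙₘ m q) (σₙₘ n p ⨾ (d ⊕ c))
    δ-assoc : AxE (δ ⨾ (δ ⊕ id₁)) (δ ⨾ (id₁ ⊕ δ))
    δ-unit  : AxE (δ ⨾ (ε ⊕ id₁)) id₁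
    δ-comm  : AxE (δ ⨾ σ) δ
    μ-assoc : AxE ((μ ⊕ id₁) ⨾ μ) ((id₁ ⊕ μ) ⨾ μ)
    μ-unit  : AxE ((η ⊕ id₁) ⨾ μ) id₁
    μ-comm  : AxE (σ ⨾ μ) μ
    frob₁   : AxE ((δ ⊕ id₁) ⨾ (id₁ ⊕ μ)) (μ ⨾ δ)
    frob₂   : AxE (μ ⨾ δ) ((id₁ ⊕ δ) ⨾ (μ ⊕ id₁))
    special : AxE (δ ⨾ μ) id₁

  data AxI : ∀ {n m} → Term S n m → Term S n m → Set where
    adj-ε₁ : AxI id₁ (ε ⨾ η)
    adj-ε₂ : AxI (η ⨾ ε) id₀
    adj-δ₁ : AxI id₁ (δ ⨾ μ)
    adj-δ₂ : AxI (μ ⨾ δ) (idₙ 2)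
    lax-δ  : ∀ {n m} (R : Signature.Sym S n m) →
             AxI (gen R ⨾ δₙ m) (δₙ n ⨾ (gen R ⊕ gen R))
    lax-ε  : ∀ {n m} (R : Signature.Sym S n m) → AxI (gen R ⨾ εₙ m) (εₙ n)

  infix 4 _≤CB_
  data _≤CB_ : ∀ {n m} → Term S n m → Term S n m → Set where
    by-E   : ∀ {n m} {c d : Term S n m} → AxE c d → c ≤CB d
    by-E⁻  : ∀ {n m} {c d : Term S n m} → AxE c d → d ≤CB c
    by-I   : ∀ {n m} {c d : Term S n m} → AxI c d → c ≤CB d
    refl≤  : ∀ {n m} (c : Term S n m) → c ≤CB c
    trans≤ : ∀ {n m} {c d e : Term S n m} → c ≤CB d → d ≤CB e → c ≤CB e
    ⨾-cong : ∀ {n z m} {c c' : Term S n z} {d d' : Term S z m} →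
             c ≤CB c' → d ≤CB d' → c ⨾ d ≤CB c' ⨾ d'
    ⊕-cong : ∀ {n m p q} {c c' : Term S n m} {d d' : Term S p q} →
             c ≤CB c' → d ≤CB d' → c ⊕ d ≤CB c' ⊕ d'

-- The ordered prop CB_Σ (arrows = terms, considered modulo ≤CB ∩ ≥CB)

CB : Signature → OrderedSMC
CB S = record
  { Obj  = ℕ
  ; Hom  = Term S
  ; _≤_  = _≤CB_
  ; id   = idₙ
  ; _⨾_  = _⨾_
  ; 𝟙    = 0
  ; _⊗₀_ = _+_
  ; _⊗₁_ = _⊕_
  ; α    = λ n p r → cast refl (+-assoc n p r) (idₙ ((n + p) + r))
  ; α⁻   = λ n p r → cast refl (sym (+-assoc n p r)) (idₙ (n + (p + r)))
  ; lu   = idₙ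
  ; lu⁻  = idₙ
  ; ru   = λ n → cast refl (+-identityʳ n) (idₙ (n + 0))
  ; ru⁻  = λ n → cast refl (sym (+-identityʳ n)) (idₙ n)
  ; σ    = σₙₘ
  }

module Submission where

open import Defs
open import Data.Nat using (ℕ; zero; suc; _+_)
open import Data.Nat.Properties using (+-assoc; +-identityʳ)
open import Data.List using (List; []; _∷_; _++_)
open import Data.Product using (Σ; _×_; _,_; proj₁; proj₂)
open import Relation.Binary.PropositionalEquality using (_≡_; refl; sym; trans; cong)
open import Data.Nat.Tactic.RingSolver using (solve; solve-∀)

-- Terms are compared up to ≤CB across sorts that are merely
-- propositionally equal: a sort (a + b) + c is not definitionally
-- a + (b + c), so even the strict monoidal laws relate terms of
-- different (but equal) sorts.
module Hetero {S : Signature} where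

  Tm : ℕ → ℕ → Set
  Tm = Term S

  I : ∀ n → Tm n n
  I = idₙ

  infix 4 _≲_ _≅_
  _≲_ : ∀ {n m n' m'} → Tm n m → Tm n' m' → Set
  _≲_ {n} {m} {n'} {m'} t u = Σ (n ≡ n') λ p → Σ (m ≡ m') λ q → cast p q t ≤CB u

  _≅_ : ∀ {n m n' m'} → Tm n m → Tm n' m' → Set
  t ≅ u = (t ≲ u) × (u ≲ t)

  ≲-refl : ∀ {n m} (t : Tm n m) → t ≲ t
  ≲-refl t = refl , refl , refl≤ t

  ≲-trans : ∀ {n m n' m' n'' m''} {t : Tm n m} {u : Tm n' m'} {v : Tm n'' m''} →
            t ≲ u → u ≲ v → t ≲ v
  ≲-trans (refl , refl , h) (refl , refl , h') = refl , refl , trans≤ h h'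

  ≤⇒≲ : ∀ {n m} {t u : Tm n m} → t ≤CB u → t ≲ u
  ≤⇒≲ h = refl , refl , h

  ≲⇒≤ : ∀ {n m} {t u : Tm n m} → t ≲ u → t ≤CB u
  ≲⇒≤ (refl , refl , h) = h

  ≅⇒≈ : ∀ {n m} {t u : Tm n m} → t ≅ u → (t ≤CB u) × (u ≤CB t)
  ≅⇒≈ (t≲u , u≲t) = ≲⇒≤ t≲u , ≲⇒≤ u≲t

  ≅-refl : ∀ {n m} (t : Tm n m) → t ≅ t
  ≅-refl t = ≲-refl t , ≲-refl t

  ≅-sym : ∀ {n m n' m'} {t : Tm n m} {u : Tm n' m'} → t ≅ u → u ≅ t
  ≅-sym (t≲u , u≲t) = u≲t , t≲u

  ≅-trans : ∀ {n m n' m' n'' m''} {t : Tm n m} {u : Tm n' m'} {v : Tm n'' m''} →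
            t ≅ u → u ≅ v → t ≅ v
  ≅-trans (t≲u , u≲t) (u≲v , v≲u) = ≲-trans t≲u u≲v , ≲-trans v≲u u≲t

  ⨾≲ : ∀ {n z m n' z' m'} {t : Tm n z} {t' : Tm n' z'} {u : Tm z m} {u' : Tm z' m'} →
       t ≲ t' → u ≲ u' → (t ⨾ u) ≲ (t' ⨾ u')
  ⨾≲ (refl , refl , h) (refl , refl , h') = refl , refl , ⨾-cong h h'

  ⊕≲ : ∀ {n m p q n' m' p' q'} {t : Tm n m} {t' : Tm n' m'} {u : Tm p q} {u' : Tm p' q'} →
       t ≲ t' → u ≲ u' → (t ⊕ u) ≲ (t' ⊕ u')
  ⊕≲ (refl , refl , h) (refl , refl , h') = refl , refl , ⊕-cong h h'

  ⨾≅ : ∀ {n z m n' z' m'} {t : Tm n z} {t' : Tm n' z'} {u : Tm z m} {u' : Tm z' m'} →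
       t ≅ t' → u ≅ u' → (t ⨾ u) ≅ (t' ⨾ u')
  ⨾≅ (a , b) (c , d) = ⨾≲ a c , ⨾≲ b d

  ⊕≅ : ∀ {n m p q n' m' p' q'} {t : Tm n m} {t' : Tm n' m'} {u : Tm p q} {u' : Tm p' q'} →
       t ≅ t' → u ≅ u' → (t ⊕ u) ≅ (t' ⊕ u')
  ⊕≅ (a , b) (c , d) = ⊕≲ a c , ⊕≲ b d

  cast≅ : ∀ {n m n' m'} (p : n ≡ n') (q : m ≡ m') (t : Tm n m) → cast p q t ≅ t
  cast≅ refl refl t = ≅-refl t

  I-cong : ∀ {n m} → n ≡ m → I n ≅ I m
  I-cong refl = ≅-refl _

  axiom≅ : ∀ {n m} {t u : Tm n m} → AxE t u → t ≅ u
  axiom≅ a = ≤⇒≲ (by-E a) , ≤⇒≲ (by-E⁻ a)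

  assoc≅ : ∀ {n z w m} (c : Tm n z) (d : Tm z w) (e : Tm w m) → ((c ⨾ d) ⨾ e) ≅ (c ⨾ (d ⨾ e))
  assoc≅ c d e = axiom≅ (⨾-assoc c d e)

  idˡ≅ : ∀ {n m} (c : Tm n m) → (I n ⨾ c) ≅ c
  idˡ≅ c = axiom≅ (⨾-idˡ c)

  idʳ≅ : ∀ {n m} (c : Tm n m) → (c ⨾ I m) ≅ c
  idʳ≅ c = axiom≅ (⨾-idʳ c)

  ⊕-assoc≅ : ∀ {n m p q r s} (c : Tm n m) (d : Tm p q) (e : Tm r s) →
             ((c ⊕ d) ⊕ e) ≅ (c ⊕ (d ⊕ e))
  ⊕-assoc≅ {n} {m} {p} {q} {r} {s} c d e =
    ≅-trans (≅-sym (cast≅ (+-assoc n p r) (+-assoc m q s) _)) (axiom≅ (⊕-assoc c d e))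

  ⊕-unitˡ≅ : ∀ {n m} (c : Tm n m) → (id₀ ⊕ c) ≅ c
  ⊕-unitˡ≅ c = axiom≅ (⊕-unitˡ c)

  ⊕-unitʳ≅ : ∀ {n m} (c : Tm n m) → (c ⊕ id₀) ≅ c
  ⊕-unitʳ≅ {n} {m} c =
    ≅-trans (≅-sym (cast≅ (+-identityʳ n) (+-identityʳ m) _)) (axiom≅ (⊕-unitʳ c))

  ⊕-id≅ : ∀ n m → (I n ⊕ I m) ≅ I (n + m)
  ⊕-id≅ n m = axiom≅ (⊕-id n m)

  I-split : ∀ a b → I (a + b) ≅ (I a ⊕ I b)
  I-split a b = ≅-sym (⊕-id≅ a b)

  interchange≅ : ∀ {n z m p w q} (c : Tm n z) (d : Tm z m) (c' : Tm p w) (d' : Tm w q) →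
                 ((c ⨾ d) ⊕ (c' ⨾ d')) ≅ ((c ⊕ c') ⨾ (d ⊕ d'))
  interchange≅ c d c' d' = axiom≅ (interch c d c' d')

  σ-natural : ∀ {n m p q} (c : Tm n m) (d : Tm p q) → ((c ⊕ d) ⨾ σₙₘ m q) ≅ (σₙₘ n p ⨾ (d ⊕ c))
  σ-natural c d = axiom≅ (σ-nat c d)

  module ≅-Reasoning where
    infix  1 begin_
    infixr 2 _≅⟨_⟩_ _≅˘⟨_⟩_
    infix  3 _∎
    begin_ : ∀ {n m n' m'} {t : Tm n m} {u : Tm n' m'} → t ≅ u → t ≅ u
    begin e = e
    _≅⟨_⟩_ : ∀ {n m n' m' n'' m''} (t : Tm n m) {u : Tm n' m'} {v : Tm n'' m''} →
             t ≅ u → u ≅ v → t ≅ v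
    t ≅⟨ e ⟩ e' = ≅-trans e e'
    _≅˘⟨_⟩_ : ∀ {n m n' m' n'' m''} (t : Tm n m) {u : Tm n' m'} {v : Tm n'' m''} →
              u ≅ t → u ≅ v → t ≅ v
    t ≅˘⟨ e ⟩ e' = ≅-trans (≅-sym e) e'
    _∎ : ∀ {n m} (t : Tm n m) → t ≅ t
    t ∎ = ≅-refl t

  module ≲-Reasoning where
    infix  1 begin≲_
    infixr 2 _≤⟨_⟩_ _≈⟨_⟩_ _≈˘⟨_⟩_
    infix  3 _∎≲
    begin≲_ : ∀ {n m n' m'} {t : Tm n m} {u : Tm n' m'} → t ≲ u → t ≲ u
    begin≲ e = e
    _≤⟨_⟩_ : ∀ {n m n' m' n'' m''} (t : Tm n m) {u : Tm n' m'} {v : Tm n'' m''} →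
             t ≲ u → u ≲ v → t ≲ v
    t ≤⟨ e ⟩ e' = ≲-trans e e'
    _≈⟨_⟩_ : ∀ {n m n' m' n'' m''} (t : Tm n m) {u : Tm n' m'} {v : Tm n'' m''} →
             t ≅ u → u ≲ v → t ≲ v
    t ≈⟨ e ⟩ e' = ≲-trans (proj₁ e) e'
    _≈˘⟨_⟩_ : ∀ {n m n' m' n'' m''} (t : Tm n m) {u : Tm n' m'} {v : Tm n'' m''} →
              u ≅ t → u ≲ v → t ≲ v
    t ≈˘⟨ e ⟩ e' = ≲-trans (proj₂ e) e'
    _∎≲ : ∀ {n m} (t : Tm n m) → t ≲ t
    t ∎≲ = ≲-refl t

  absorbˡ : ∀ {a b k m} {e : Tm a b} → e ≅ I k → (t : Tm b m) → (e ⨾ t) ≅ t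
  absorbˡ e≅I@((refl , refl , _) , _) t = ≅-trans (⨾≅ e≅I (≅-refl t)) (idˡ≅ t)

  absorbʳ : ∀ {a b k n} {e : Tm a b} → e ≅ I k → (t : Tm n a) → (t ⨾ e) ≅ t
  absorbʳ e≅I@((refl , refl , _) , _) t = ≅-trans (⨾≅ (≅-refl t) e≅I) (idʳ≅ t)

  ⊕-idlike : ∀ {a b c d k l} {e : Tm a b} {f : Tm c d} → e ≅ I k → f ≅ I l → (e ⊕ f) ≅ I (k + l)
  ⊕-idlike e f = ≅-trans (⊕≅ e f) (⊕-id≅ _ _)

  ⨾-idlike : ∀ {a b c k k'} {e : Tm a b} {f : Tm b c} → e ≅ I k → f ≅ I k' → (e ⨾ f) ≅ I k'
  ⨾-idlike e f = ≅-trans (absorbˡ e _) f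

  idlike-unique : ∀ {a b k k'} {t u : Tm a b} → t ≅ I k → u ≅ I k' → t ≅ u
  idlike-unique t≅I@((refl , refl , _) , _) u≅I@((refl , refl , _) , _) = ≅-trans t≅I (≅-sym u≅I)

  id₁≅I : id₁ ≅ I 1
  id₁≅I = ≅-sym (⊕-unitʳ≅ id₁)

  ⊕I-split : ∀ {n z m} k (t : Tm n z) (u : Tm z m) → ((t ⨾ u) ⊕ I k) ≅ ((t ⊕ I k) ⨾ (u ⊕ I k))
  ⊕I-split k t u = ≅-trans (⊕≅ (≅-refl _) (≅-sym (idˡ≅ (I k)))) (interchange≅ t u (I k) (I k))

  I⊕-split : ∀ {n z m} k (t : Tm n z) (u : Tm z m) → (I k ⊕ (t ⨾ u)) ≅ ((I k ⊕ t) ⨾ (I k ⊕ u))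
  I⊕-split k t u = ≅-trans (⊕≅ (≅-sym (idˡ≅ (I k))) (≅-refl _)) (interchange≅ (I k) (I k) t u)

  id₁⊕-split : ∀ {n z m} (t : Tm n z) (u : Tm z m) → (id₁ ⊕ (t ⨾ u)) ≅ ((id₁ ⊕ t) ⨾ (id₁ ⊕ u))
  id₁⊕-split t u =
    ≅-trans (⊕≅ id₁≅I (≅-refl _))
      (≅-trans (I⊕-split 1 t u) (≅-sym (⨾≅ (⊕≅ id₁≅I (≅-refl t)) (⊕≅ id₁≅I (≅-refl u)))))

  ⊕-stagedˡ : ∀ {n m p q} (t : Tm n m) (u : Tm p q) → (t ⊕ u) ≅ ((t ⊕ I p) ⨾ (I m ⊕ u))
  ⊕-stagedˡ {m = m} {p = p} t u =
    ≅-trans (⊕≅ (≅-sym (idʳ≅ t)) (≅-sym (idˡ≅ u))) (interchange≅ t (I m) (I p) u)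

  ⊕-stagedʳ : ∀ {n m p q} (t : Tm n m) (u : Tm p q) → (t ⊕ u) ≅ ((I n ⊕ u) ⨾ (t ⊕ I q))
  ⊕-stagedʳ {n = n} {q = q} t u =
    ≅-trans (⊕≅ (≅-sym (idˡ≅ t)) (≅-sym (idʳ≅ u))) (interchange≅ (I n) t u (I q))

  inverse-cancel : ∀ {n k n' m j j'} {A : Tm n k} {B : Tm k n'} {D : Tm n' m} →
                   (A ⨾ B) ≅ I j → (B ⨾ D) ≅ I j' → A ≅ D
  inverse-cancel {A = A} {B} {D} e1 e2 =
    ≅-trans (≅-sym (absorbʳ e2 A)) (≅-trans (≅-sym (assoc≅ A B D)) (absorbˡ e1 D))

  ⊕I-inverse : ∀ {n m} k {x : Tm n m} {y : Tm m n} → (x ⨾ y) ≅ I n →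
               ((x ⊕ I k) ⨾ (y ⊕ I k)) ≅ I (n + k)
  ⊕I-inverse k e = ≅-trans (≅-sym (⊕I-split k _ _)) (⊕-idlike e (≅-refl (I k)))

  I⊕-inverse : ∀ {n m} k {x : Tm n m} {y : Tm m n} → (x ⨾ y) ≅ I n →
               ((I k ⊕ x) ⨾ (I k ⊕ y)) ≅ I (k + n)
  I⊕-inverse k e = ≅-trans (≅-sym (I⊕-split k _ _)) (⊕-idlike (≅-refl (I k)) e)

  regroup₄ : ∀ {n₀ n₁ n₂ n₃ n₄} (a : Tm n₀ n₁) (b : Tm n₁ n₂) (c : Tm n₂ n₃) (d : Tm n₃ n₄) →
             ((a ⨾ b) ⨾ (c ⨾ d)) ≅ (a ⨾ ((b ⨾ c) ⨾ d))
  regroup₄ a b c d = ≅-trans (assoc≅ a b (c ⨾ d)) (⨾≅ (≅-refl a) (≅-sym (assoc≅ b c d)))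

  disjoint-⨾ˡ : ∀ {a b n m q r k l} {e : Tm a b} {t : Tm n m} {u : Tm b q} {f : Tm m r} →
                e ≅ I k → f ≅ I l → ((e ⊕ t) ⨾ (u ⊕ f)) ≅ (u ⊕ t)
  disjoint-⨾ˡ {t = t} {u} e≅I f≅I =
    ≅-trans (≅-sym (interchange≅ _ u t _)) (⊕≅ (absorbˡ e≅I u) (absorbʳ f≅I t))

  disjoint-⨾ʳ : ∀ {a b n m q r k l} {t : Tm n m} {e : Tm a b} {f : Tm m r} {u : Tm b q} →
                e ≅ I k → f ≅ I l → ((t ⊕ e) ⨾ (f ⊕ u)) ≅ (t ⊕ u)
  disjoint-⨾ʳ {t = t} {u = u} e≅I f≅I =
    ≅-trans (≅-sym (interchange≅ t _ _ u)) (⊕≅ (absorbʳ f≅I t) (absorbˡ e≅I u))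

-- Strict associativity and unitality of ⊕ as a normalisation procedure:
-- two ⊕-trees of terms with the same list of leaves denote equal terms.
module Rebracket {S : Signature} where
  open Hetero {S}

  record Leaf : Set where
    constructor leaf′
    field
      {dom cod} : ℕ
      term : Tm dom cod

  infixr 10 _⊗_
  data ⊕Tree : Set where
    leaf : ∀ {n m} → Tm n m → ⊕Tree
    _⊗_  : ⊕Tree → ⊕Tree → ⊕Tree

  domT codT : ⊕Tree → ℕ
  domT (leaf {n} t) = n
  domT (a ⊗ b)      = domT a + domT b
  codT (leaf {m = m} t) = m
  codT (a ⊗ b)          = codT a + codT b

  ⟦_⟧ : (t : ⊕Tree) → Tm (domT t) (codT t)
  ⟦ leaf t ⟧ = t
  ⟦ a ⊗ b ⟧  = ⟦ a ⟧ ⊕ ⟦ b ⟧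

  domL codL : List Leaf → ℕ
  domL []                      = 0
  domL (leaf′ {dom = n} t ∷ l) = n + domL l
  codL []                      = 0
  codL (leaf′ {cod = m} t ∷ l) = m + codL l

  ⟦_⟧L : (l : List Leaf) → Tm (domL l) (codL l)
  ⟦ [] ⟧L          = id₀
  ⟦ leaf′ t ∷ l ⟧L = t ⊕ ⟦ l ⟧L

  [I] : ℕ → ⊕Tree
  [I] n = leaf (I n)

  [σ] : ℕ → ℕ → ⊕Tree
  [σ] n m = leaf (σₙₘ n m)

  leaves : ⊕Tree → List Leaf
  leaves (leaf t) = leaf′ t ∷ []
  leaves (a ⊗ b)  = leaves a ++ leaves b

  ⟦++⟧L : ∀ l l' → ⟦ l ++ l' ⟧L ≅ (⟦ l ⟧L ⊕ ⟦ l' ⟧L)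
  ⟦++⟧L [] l'            = ≅-sym (⊕-unitˡ≅ _)
  ⟦++⟧L (leaf′ t ∷ l) l' = ≅-trans (⊕≅ (≅-refl t) (⟦++⟧L l l')) (≅-sym (⊕-assoc≅ _ _ _))

  ⟦leaves⟧ : ∀ t → ⟦ t ⟧ ≅ ⟦ leaves t ⟧L
  ⟦leaves⟧ (leaf t) = ≅-sym (⊕-unitʳ≅ t)
  ⟦leaves⟧ (a ⊗ b)  = ≅-trans (⊕≅ (⟦leaves⟧ a) (⟦leaves⟧ b)) (≅-sym (⟦++⟧L (leaves a) (leaves b)))

  ⊕-rebracket : ∀ t u → leaves t ≡ leaves u → ⟦ t ⟧ ≅ ⟦ u ⟧
  ⊕-rebracket t u same = ≅-trans (⟦leaves⟧ t) (≅-trans (⟦≡⟧ same) (≅-sym (⟦leaves⟧ u)))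
    where
      ⟦≡⟧ : ∀ {l l'} → l ≡ l' → ⟦ l ⟧L ≅ ⟦ l' ⟧L
      ⟦≡⟧ refl = ≅-refl _

module Symmetry {S : Signature} where
  open Hetero {S}
  open ≅-Reasoning

  σ-zeroˡ : ∀ m → σₙₘ 0 m ≅ I m
  σ-zeroˡ m = cast≅ refl _ _

  σ-suc : ∀ n m → σₙₘ (suc n) m ≅ ((id₁ ⊕ σₙₘ n m) ⨾ (σ₁ₙ m ⊕ I n))
  σ-suc n m = ⨾≅ (≅-refl _) (cast≅ _ _ _)

  σ-oneˡ : ∀ m → σₙₘ 1 m ≅ σ₁ₙ m
  σ-oneˡ m = ≅-trans (σ-suc 0 m)
               (≅-trans (⨾≅ (⊕≅ (≅-refl id₁) (σ-zeroˡ m)) (⊕-unitʳ≅ (σ₁ₙ m))) (idˡ≅ (σ₁ₙ m)))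

  σ₁ₙ-one : σ₁ₙ 1 ≅ σ
  σ₁ₙ-one = ≅-trans (⨾≅ (⊕-unitʳ≅ σ) (⊕-idlike id₁≅I id₁≅I)) (idʳ≅ σ)

  σ-one-one : σₙₘ 1 1 ≅ σ
  σ-one-one = ≅-trans (σ-oneˡ 1) σ₁ₙ-one

  σ-involutive : (σ ⨾ σ) ≅ I 2
  σ-involutive = axiom≅ σ-inv

  σ₁ₙ-split : ∀ a b → σ₁ₙ (a + b) ≅ ((σ₁ₙ a ⊕ I b) ⨾ cast (sym (+-assoc a 1 b)) refl (I a ⊕ σ₁ₙ b))
  σ₁ₙ-split zero b = ≅-sym (≅-trans (idˡ≅ _) (⊕-unitˡ≅ _))
  σ₁ₙ-split (suc a) b = begin
      (σ ⊕ I (a + b)) ⨾ (id₁ ⊕ σ₁ₙ (a + b))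
    ≅⟨ ⨾≅ (≅-refl _) (≅-trans (⊕≅ (≅-refl id₁) (σ₁ₙ-split a b)) (id₁⊕-split _ _)) ⟩
      (σ ⊕ I (a + b)) ⨾ ((id₁ ⊕ (σ₁ₙ a ⊕ I b)) ⨾ (id₁ ⊕ C))
    ≅˘⟨ assoc≅ _ _ _ ⟩
      ((σ ⊕ I (a + b)) ⨾ (id₁ ⊕ (σ₁ₙ a ⊕ I b))) ⨾ (id₁ ⊕ C)
    ≅⟨ ⨾≅ (⨾≅ (≅-sym (≅-trans (⊕-assoc≅ _ _ _) (⊕≅ (≅-refl σ) (⊕-id≅ a b))))
              (≅-sym (⊕-assoc≅ _ _ _)))
          (≅-trans (⊕≅ (≅-refl id₁) (cast≅ (sym (+-assoc a 1 b)) refl (I a ⊕ σ₁ₙ b)))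
             (≅-trans (≅-sym (⊕-assoc≅ id₁ (I a) (σ₁ₙ b))) (≅-sym (cast≅ _ _ _)))) ⟩
      (((σ ⊕ I a) ⊕ I b) ⨾ ((id₁ ⊕ σ₁ₙ a) ⊕ I b)) ⨾ cast (sym (+-assoc (suc a) 1 b)) refl (I (suc a) ⊕ σ₁ₙ b)
    ≅˘⟨ ⨾≅ (⊕I-split b _ _) (≅-refl _) ⟩
      (σ₁ₙ (suc a) ⊕ I b) ⨾ cast (sym (+-assoc (suc a) 1 b)) refl (I (suc a) ⊕ σ₁ₙ b)
    ∎
    where
      C = cast (sym (+-assoc a 1 b)) refl (I a ⊕ σ₁ₙ b)

  σ-hexagonʳ : ∀ x y z → σₙₘ x (y + z) ≅ ((σₙₘ x y ⊕ I z) ⨾ cast (sym (+-assoc y x z)) refl (I y ⊕ σₙₘ x z))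
  σ-hexagonʳ zero y z =
    ≅-trans (σ-zeroˡ (y + z))
      (≅-sym (≅-trans (absorbˡ (⊕-idlike (σ-zeroˡ y) (≅-refl (I z))) _)
               (≅-trans (cast≅ _ _ _) (⊕-idlike (≅-refl (I y)) (σ-zeroˡ z)))))
  σ-hexagonʳ (suc x) y z = begin
      σₙₘ (suc x) (y + z)
    ≅⟨ σ-suc x (y + z) ⟩
      (id₁ ⊕ σₙₘ x (y + z)) ⨾ (σ₁ₙ (y + z) ⊕ I x)
    ≅⟨ ⨾≅ (≅-trans (⊕≅ (≅-refl id₁) (≅-trans (σ-hexagonʳ x y z)
                  (⨾≅ (≅-refl _) (≅-sym (cast≅ refl (sym (+-assoc y z x)) C1))))) (id₁⊕-split _ _))
          (≅-trans (⊕≅ (σ₁ₙ-split y z) (≅-refl (I x))) (⊕I-split x _ _)) ⟩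
      (A1 ⨾ A2) ⨾ (A3 ⨾ A4)
    ≅⟨ regroup₄ _ _ _ _ ⟩
      A1 ⨾ ((A2 ⨾ A3) ⨾ A4)
    ≅⟨ ⨾≅ (≅-sym (⊕-assoc≅ _ _ _))
          (⨾≅ middle-layers (≅-trans (⊕≅ (cast≅ _ _ _) (≅-refl (I x))) (⊕-assoc≅ _ _ _))) ⟩
      B1 ⨾ ((B2 ⨾ B3) ⨾ B4)
    ≅˘⟨ regroup₄ _ _ _ _ ⟩
      (B1 ⨾ B2) ⨾ (B3 ⨾ B4)
    ≅˘⟨ ⨾≅ (≅-trans (⊕≅ (σ-suc x y) (≅-refl (I z))) (⊕I-split z _ _))
          (≅-trans (cast≅ _ _ _) (≅-trans (⊕≅ (≅-refl (I y)) (σ-suc x z))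
             (≅-trans (I⊕-split y _ _) (⨾≅ (≅-sym (cast≅ p refl _)) (≅-refl B4))))) ⟩
      (σₙₘ (suc x) y ⊕ I z) ⨾ cast (sym (+-assoc y (suc x) z)) refl (I y ⊕ σₙₘ (suc x) z)
    ∎
    where
      C1 = cast (sym (+-assoc y x z)) refl (I y ⊕ σₙₘ x z)
      p : y + suc (x + z) ≡ ((y + 1) + x) + z
      p = trans (sym (+-assoc y (suc x) z)) (cong (_+ z) (sym (+-assoc y 1 x)))
      A1 = id₁ ⊕ (σₙₘ x y ⊕ I z)
      A2 = id₁ ⊕ cast refl (sym (+-assoc y z x)) C1
      A3 = (σ₁ₙ y ⊕ I z) ⊕ I x
      A4 = cast (sym (+-assoc y 1 z)) refl (I y ⊕ σ₁ₙ z) ⊕ I x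
      B1 = (id₁ ⊕ σₙₘ x y) ⊕ I z
      B2 = (σ₁ₙ y ⊕ I x) ⊕ I z
      B3 = cast p refl (I y ⊕ (id₁ ⊕ σₙₘ x z))
      B4 = I y ⊕ (σ₁ₙ z ⊕ I x)
      -- the crossings of the first wire over y and of the other x wires over z are independent
      middle-layers : (A2 ⨾ A3) ≅ (B2 ⨾ B3)
      middle-layers = begin
          A2 ⨾ A3
        ≅⟨ ⨾≅ (≅-trans (⊕≅ (≅-refl id₁) (≅-trans (cast≅ refl (sym (+-assoc y z x)) C1) (cast≅ _ _ _)))
                       (≅-sym (⊕-assoc≅ _ _ _)))
              (⊕-assoc≅ _ _ _) ⟩
          ((id₁ ⊕ I y) ⊕ σₙₘ x z) ⨾ (σ₁ₙ y ⊕ (I z ⊕ I x))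
        ≅⟨ disjoint-⨾ˡ (⊕-idlike id₁≅I (≅-refl (I y))) (⊕-id≅ z x) ⟩
          σ₁ₙ y ⊕ σₙₘ x z
        ≅˘⟨ disjoint-⨾ʳ (⊕-id≅ x z) (⊕-idlike (≅-refl (I y)) id₁≅I) ⟩
          (σ₁ₙ y ⊕ (I x ⊕ I z)) ⨾ ((I y ⊕ id₁) ⊕ σₙₘ x z)
        ≅˘⟨ ⨾≅ (⊕-assoc≅ _ _ _) (≅-trans (cast≅ _ _ _) (≅-sym (⊕-assoc≅ _ _ _))) ⟩
          B2 ⨾ B3
        ∎

  σ₁ₙ-inverse : ∀ m → (σ₁ₙ m ⨾ σₙₘ m 1) ≅ I (1 + m)
  σ₁ₙ-inverse zero = ≅-trans (absorbʳ (σ-zeroˡ 1) id₁) id₁≅I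
  σ₁ₙ-inverse (suc m) = begin
      ((σ ⊕ I m) ⨾ (id₁ ⊕ σ₁ₙ m)) ⨾ σₙₘ (suc m) 1
    ≅⟨ ⨾≅ (≅-refl _) (σ-suc m 1) ⟩
      ((σ ⊕ I m) ⨾ (id₁ ⊕ σ₁ₙ m)) ⨾ ((id₁ ⊕ σₙₘ m 1) ⨾ (σ₁ₙ 1 ⊕ I m))
    ≅⟨ regroup₄ _ _ _ _ ⟩
      (σ ⊕ I m) ⨾ (((id₁ ⊕ σ₁ₙ m) ⨾ (id₁ ⊕ σₙₘ m 1)) ⨾ (σ₁ₙ 1 ⊕ I m))
    ≅⟨ ⨾≅ (≅-refl _) (absorbˡ (≅-trans (≅-sym (id₁⊕-split _ _)) (⊕-idlike id₁≅I (σ₁ₙ-inverse m))) _) ⟩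
      (σ ⊕ I m) ⨾ (σ₁ₙ 1 ⊕ I m)
    ≅˘⟨ interchange≅ _ _ _ _ ⟩
      (σ ⨾ σ₁ₙ 1) ⊕ (I m ⨾ I m)
    ≅⟨ ⊕-idlike (≅-trans (⨾≅ (≅-refl σ) σ₁ₙ-one) σ-involutive) (idˡ≅ (I m)) ⟩
      I (2 + m)
    ∎

  σ-zeroʳ : ∀ m → σₙₘ m 0 ≅ I m
  σ-zeroʳ zero    = σ-zeroˡ 0
  σ-zeroʳ (suc m) = ≅-trans (σ-suc m 0) (absorbˡ (⊕-idlike id₁≅I (σ-zeroʳ m)) _)

  σ-inverse : ∀ n m → (σₙₘ n m ⨾ σₙₘ m n) ≅ I (n + m)
  σ-inverse zero m = ≅-trans (absorbˡ (σ-zeroˡ m) _) (σ-zeroʳ m)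
  σ-inverse (suc n) m = begin
      σₙₘ (suc n) m ⨾ σₙₘ m (suc n)
    ≅⟨ ⨾≅ (σ-suc n m) (σ-hexagonʳ m 1 n) ⟩
      ((id₁ ⊕ σₙₘ n m) ⨾ (σ₁ₙ m ⊕ I n)) ⨾ ((σₙₘ m 1 ⊕ I n) ⨾ C)
    ≅⟨ regroup₄ _ _ _ _ ⟩
      (id₁ ⊕ σₙₘ n m) ⨾ (((σ₁ₙ m ⊕ I n) ⨾ (σₙₘ m 1 ⊕ I n)) ⨾ C)
    ≅⟨ ⨾≅ (≅-refl _) (absorbˡ (⊕I-inverse n (σ₁ₙ-inverse m)) _) ⟩
      (id₁ ⊕ σₙₘ n m) ⨾ C
    ≅⟨ ⨾≅ (≅-refl _) (≅-trans (cast≅ _ _ _) (⊕≅ (≅-sym id₁≅I) (≅-refl (σₙₘ m n)))) ⟩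
      (id₁ ⊕ σₙₘ n m) ⨾ (id₁ ⊕ σₙₘ m n)
    ≅˘⟨ id₁⊕-split _ _ ⟩
      id₁ ⊕ (σₙₘ n m ⨾ σₙₘ m n)
    ≅⟨ ⊕-idlike id₁≅I (σ-inverse n m) ⟩
      I (1 + (n + m))
    ∎
    where
      C = cast (sym (+-assoc 1 m n)) refl (I 1 ⊕ σₙₘ m n)

  -- the other hexagon, obtained from the first by inverting symmetries
  σ-hexagonˡ : ∀ x y z → σₙₘ (x + y) z ≅ ((I x ⊕ σₙₘ y z) ⨾ cast (+-assoc x z y) refl (σₙₘ x z ⊕ I y))
  σ-hexagonˡ x y z =
    inverse-cancel (≅-trans (⨾≅ (≅-refl _) (cast≅ _ _ _)) (σ-inverse (x + y) z)) inverse
    where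
      C1 = cast (sym (+-assoc x z y)) refl (I x ⊕ σₙₘ z y)
      C2 = cast (+-assoc x z y) refl (σₙₘ x z ⊕ I y)
      B  = cast refl (+-assoc x y z) (σₙₘ z (x + y))
      inverse : (B ⨾ ((I x ⊕ σₙₘ y z) ⨾ C2)) ≅ I (z + (x + y))
      inverse = begin
          B ⨾ ((I x ⊕ σₙₘ y z) ⨾ C2)
        ≅⟨ ⨾≅ (≅-trans (cast≅ _ _ _) (σ-hexagonʳ z x y)) (≅-refl _) ⟩
          ((σₙₘ z x ⊕ I y) ⨾ C1) ⨾ ((I x ⊕ σₙₘ y z) ⨾ C2)
        ≅⟨ regroup₄ _ _ _ _ ⟩
          (σₙₘ z x ⊕ I y) ⨾ ((C1 ⨾ (I x ⊕ σₙₘ y z)) ⨾ C2)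
        ≅⟨ ⨾≅ (≅-refl _) (≅-trans (absorbˡ (≅-trans (⨾≅ (cast≅ _ _ _) (≅-refl _))
                                            (I⊕-inverse x (σ-inverse z y))) C2) (cast≅ _ _ _)) ⟩
          (σₙₘ z x ⊕ I y) ⨾ (σₙₘ x z ⊕ I y)
        ≅⟨ ≅-trans (⊕I-inverse y (σ-inverse z x)) (I-cong (+-assoc z x y)) ⟩
          I (z + (x + y))
        ∎

+-shuffle₆ : ∀ x₁ x₂ x₃ y₁ y₂ y₃ →
             (x₁ + (x₂ + x₃)) + (y₁ + (y₂ + y₃)) ≡ ((x₁ + x₂) + x₃) + ((y₁ + y₂) + y₃)
+-shuffle₆ = solve-∀

-- It is what makes ⊕ of two
-- (co)monoids a (co)monoid; here we establish that it is natural,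
-- self-inverse up to renaming, and coherent with associativity and symmetry.
module MiddleFour {S : Signature} where
  open Hetero {S}
  open Rebracket {S}
  open Symmetry {S}
  open ≅-Reasoning

  τ : ∀ a b c d → Tm ((a + b) + (c + d)) ((a + c) + (b + d))
  τ a b c d = cast (trans (cong (a +_) (+-assoc b c d)) (sym (+-assoc a b (c + d))))
                   (trans (cong (a +_) (+-assoc c b d)) (sym (+-assoc a c (b + d))))
                   (I a ⊕ (σₙₘ b c ⊕ I d))

  middle : ∀ a {n m} → Tm n m → ∀ d → Tm (a + (n + d)) (a + (m + d))
  middle a x d = I a ⊕ (x ⊕ I d)

  τ≅middle : ∀ a b c d → τ a b c d ≅ middle a (σₙₘ b c) d
  τ≅middle a b c d = cast≅ _ _ _

  middle-⨾ : ∀ a {n z m} (x : Tm n z) (y : Tm z m) d →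
             (middle a x d ⨾ middle a y d) ≅ middle a (x ⨾ y) d
  middle-⨾ a x y d = ≅-trans (≅-sym (I⊕-split a _ _)) (⊕≅ (≅-refl (I a)) (≅-sym (⊕I-split d x y)))

  middle-split : ∀ a {n z m n' m'} {x : Tm n' m'} (y : Tm n z) (w : Tm z m) d → x ≅ (y ⨾ w) →
                 middle a x d ≅ (middle a y d ⨾ middle a w d)
  middle-split a y w d e = ≅-trans (⊕≅ (≅-refl (I a)) (⊕≅ e (≅-refl (I d)))) (≅-sym (middle-⨾ a y w d))

  middle-idlike : ∀ a {n m k} {x : Tm n m} d → x ≅ I k → middle a x d ≅ I (a + (k + d))
  middle-idlike a d e = ⊕-idlike (≅-refl (I a)) (⊕-idlike e (≅-refl (I d)))

  τ-inverse : ∀ a b c d → (τ a b c d ⨾ τ a c b d) ≅ I ((a + b) + (c + d))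
  τ-inverse a b c d =
    ≅-trans (⨾≅ (τ≅middle a b c d) (τ≅middle a c b d))
      (≅-trans (middle-⨾ a _ _ d) (≅-trans (middle-idlike a d (σ-inverse b c))
        (I-cong (trans (cong (a +_) (+-assoc b c d)) (sym (+-assoc a b (c + d)))))))

  τ-trivial : ∀ b c → τ 0 b 0 c ≅ I (b + c)
  τ-trivial b c = ≅-trans (τ≅middle 0 b 0 c) (middle-idlike 0 c (σ-zeroʳ b))

  τ-trivial′ : ∀ b c → τ 0 0 b c ≅ I (b + c)
  τ-trivial′ b c = ≅-trans (τ≅middle 0 0 b c) (middle-idlike 0 c (σ-zeroˡ b))

  ⊕-reassoc₄ : ∀ {a a' b b' c c' d d'} (f : Tm a a') (g : Tm b b') (h : Tm c c') (k : Tm d d') →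
               ((f ⊕ g) ⊕ (h ⊕ k)) ≅ (f ⊕ ((g ⊕ h) ⊕ k))
  ⊕-reassoc₄ f g h k = ≅-trans (⊕-assoc≅ _ _ _) (⊕≅ (≅-refl f) (≅-sym (⊕-assoc≅ _ _ _)))

  τ-natural : ∀ {a a' b b' c c' d d'} (f : Tm a a') (g : Tm b b') (h : Tm c c') (k : Tm d d') →
              (((f ⊕ g) ⊕ (h ⊕ k)) ⨾ τ a' b' c' d') ≅ (τ a b c d ⨾ ((f ⊕ h) ⊕ (g ⊕ k)))
  τ-natural {a} {a'} {b} {b'} {c} {c'} {d} {d'} f g h k = begin
      ((f ⊕ g) ⊕ (h ⊕ k)) ⨾ τ a' b' c' d'
    ≅⟨ ⨾≅ (⊕-reassoc₄ f g h k) (τ≅middle _ _ _ _) ⟩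
      (f ⊕ ((g ⊕ h) ⊕ k)) ⨾ middle a' (σₙₘ b' c') d'
    ≅˘⟨ interchange≅ _ _ _ _ ⟩
      (f ⨾ I a') ⊕ (((g ⊕ h) ⊕ k) ⨾ (σₙₘ b' c' ⊕ I d'))
    ≅⟨ ⊕≅ (≅-trans (idʳ≅ f) (≅-sym (idˡ≅ f)))
          (≅-trans (≅-sym (interchange≅ _ _ _ _))
            (≅-trans (⊕≅ (σ-natural g h) (≅-trans (idʳ≅ k) (≅-sym (idˡ≅ k)))) (interchange≅ _ _ _ _))) ⟩
      (I a ⨾ f) ⊕ ((σₙₘ b c ⊕ I d) ⨾ ((h ⊕ g) ⊕ k))
    ≅⟨ interchange≅ _ _ _ _ ⟩
      middle a (σₙₘ b c) d ⨾ (f ⊕ ((h ⊕ g) ⊕ k))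
    ≅˘⟨ ⨾≅ (τ≅middle _ _ _ _) (⊕-reassoc₄ f h g k) ⟩
      τ a b c d ⨾ ((f ⊕ h) ⊕ (g ⊕ k))
    ∎

  σ-sum : ∀ a b c d → σₙₘ (a + b) (c + d) ≅ (τ a b c d ⨾ ((σₙₘ a c ⊕ σₙₘ b d) ⨾ τ c a d b))
  σ-sum a b c d = begin
      σₙₘ (a + b) (c + d)
    ≅⟨ σ-hexagonˡ a b (c + d) ⟩
      (I a ⊕ σₙₘ b (c + d)) ⨾ cast (+-assoc a (c + d) b) refl (σₙₘ a (c + d) ⊕ I b)
    ≅⟨ ⨾≅ (≅-trans (⊕≅ (≅-refl (I a)) (σ-hexagonʳ b c d)) (I⊕-split a _ _))
          (≅-trans (cast≅ _ _ _) (≅-trans (⊕≅ (σ-hexagonʳ a c d) (≅-refl (I b)))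
             (≅-trans (⊕I-split b _ _) (⨾≅ (≅-sym (cast≅ p refl _)) (≅-refl _))))) ⟩
      (L1 ⨾ L2) ⨾ (cast p refl R1 ⨾ R2)
    ≅⟨ regroup₄ _ _ _ _ ⟩
      L1 ⨾ ((L2 ⨾ cast p refl R1) ⨾ R2)
    ≅⟨ ⨾≅ (≅-sym (τ≅middle a b c d))
          (⨾≅ inner (≅-trans (⊕≅ (cast≅ _ _ _) (≅-refl (I b)))
                       (≅-trans (⊕-assoc≅ _ _ _) (≅-sym (τ≅middle c a d b))))) ⟩
      τ a b c d ⨾ ((σₙₘ a c ⊕ σₙₘ b d) ⨾ τ c a d b)
    ∎
    where
      p : ((a + c) + d) + b ≡ a + (c + (d + b))
      p = trans (+-assoc (a + c) d b) (+-assoc a c (d + b))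
      L1 = I a ⊕ (σₙₘ b c ⊕ I d)
      L2 = I a ⊕ cast (sym (+-assoc c b d)) refl (I c ⊕ σₙₘ b d)
      R1 = (σₙₘ a c ⊕ I d) ⊕ I b
      R2 = cast (sym (+-assoc c a d)) refl (I c ⊕ σₙₘ a d) ⊕ I b
      inner : (L2 ⨾ cast p refl R1) ≅ (σₙₘ a c ⊕ σₙₘ b d)
      inner = begin
          L2 ⨾ cast p refl R1
        ≅⟨ ⨾≅ (≅-trans (⊕≅ (≅-refl (I a)) (cast≅ _ _ _)) (≅-sym (⊕-assoc≅ _ _ _)))
              (≅-trans (cast≅ _ _ _) (⊕-assoc≅ _ _ _)) ⟩
          ((I a ⊕ I c) ⊕ σₙₘ b d) ⨾ (σₙₘ a c ⊕ (I d ⊕ I b))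
        ≅⟨ disjoint-⨾ˡ (⊕-id≅ a c) (⊕-id≅ d b) ⟩
          σₙₘ a c ⊕ σₙₘ b d
        ∎

  τ-σ : ∀ a b c d → (τ a c b d ⨾ σₙₘ (a + b) (c + d)) ≅ ((σₙₘ a c ⊕ σₙₘ b d) ⨾ τ c a d b)
  τ-σ a b c d = ≅-trans (⨾≅ (≅-refl _) (σ-sum a b c d))
                  (≅-trans (≅-sym (assoc≅ _ _ _)) (absorbˡ (τ-inverse a c b d) _))

  σ-τ : ∀ a a' b b' → (σₙₘ (a + a') (b + b') ⨾ τ b b' a a') ≅ (τ a a' b b' ⨾ (σₙₘ a b ⊕ σₙₘ a' b'))
  σ-τ a a' b b' = ≅-trans (⨾≅ (σ-sum a a' b b') (≅-refl _))
                    (≅-trans (assoc≅ _ _ _)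
                      (⨾≅ (≅-refl _) (≅-trans (assoc≅ _ _ _) (absorbʳ (τ-inverse b a b' a') _))))

  τ-zip-assoc : ∀ x₁ x₂ x₃ y₁ y₂ y₃ →
                (τ (x₁ + x₂) x₃ (y₁ + y₂) y₃ ⨾ (τ x₁ x₂ y₁ y₂ ⊕ I (x₃ + y₃)))
                ≅ (τ x₁ (x₂ + x₃) y₁ (y₂ + y₃) ⨾ (I (x₁ + y₁) ⊕ τ x₂ x₃ y₂ y₃))
  τ-zip-assoc x₁ x₂ x₃ y₁ y₂ y₃ = begin
      τ (x₁ + x₂) x₃ (y₁ + y₂) y₃ ⨾ (τ x₁ x₂ y₁ y₂ ⊕ I (x₃ + y₃))
    ≅⟨ ⨾≅ (≅-trans (τ≅middle _ _ _ _) (≅-trans (middle-split (x₁ + x₂) _ _ y₃ (σ-hexagonʳ x₃ y₁ y₂))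
             (⨾≅ (≅-refl _) (≅-sym (cast≅ refl q₁ _))))) (≅-refl _) ⟩
      (M₁ ⨾ M₂) ⨾ T₁
    ≅⟨ assoc≅ _ _ _ ⟩
      M₁ ⨾ (M₂ ⨾ T₁)
    ≅⟨ ⨾≅ M₁≅N₁ (≅-trans M₂T₁≅K (≅-sym N₂T₂≅K)) ⟩
      N₁ ⨾ (N₂ ⨾ T₂)
    ≅˘⟨ assoc≅ _ _ _ ⟩
      (N₁ ⨾ N₂) ⨾ T₂
    ≅˘⟨ ⨾≅ (≅-trans (τ≅middle _ _ _ _) (≅-trans (middle-split x₁ _ _ (y₂ + y₃) (σ-hexagonˡ x₂ x₃ y₁))
             (⨾≅ (≅-sym (cast≅ p₂ refl _)) (≅-sym (cast≅ refl q₂ _))))) (≅-refl _) ⟩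
      τ x₁ (x₂ + x₃) y₁ (y₂ + y₃) ⨾ (I (x₁ + y₁) ⊕ τ x₂ x₃ y₂ y₃)
    ∎
    where
      q₁ : (x₁ + x₂) + ((y₁ + (y₂ + x₃)) + y₃) ≡ ((x₁ + x₂) + (y₁ + y₂)) + (x₃ + y₃)
      q₁ = solve (x₁ ∷ x₂ ∷ x₃ ∷ y₁ ∷ y₂ ∷ y₃ ∷ [])
      p₂ : x₁ + ((x₂ + (x₃ + y₁)) + (y₂ + y₃)) ≡ (x₁ + (x₂ + x₃)) + (y₁ + (y₂ + y₃))
      p₂ = solve (x₁ ∷ x₂ ∷ x₃ ∷ y₁ ∷ y₂ ∷ y₃ ∷ [])
      q₂ : x₁ + (((y₁ + x₂) + x₃) + (y₂ + y₃)) ≡ (x₁ + y₁) + ((x₂ + x₃) + (y₂ + y₃))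
      q₂ = solve (x₁ ∷ x₂ ∷ x₃ ∷ y₁ ∷ y₂ ∷ y₃ ∷ [])
      M₁ = middle (x₁ + x₂) (σₙₘ x₃ y₁ ⊕ I y₂) y₃
      M₂ = cast refl q₁ (middle (x₁ + x₂) (cast (sym (+-assoc y₁ x₃ y₂)) refl (I y₁ ⊕ σₙₘ x₃ y₂)) y₃)
      T₁ = τ x₁ x₂ y₁ y₂ ⊕ I (x₃ + y₃)
      N₁ = cast p₂ refl (middle x₁ (I x₂ ⊕ σₙₘ x₃ y₁) (y₂ + y₃))
      N₂ = cast refl q₂ (middle x₁ (cast (+-assoc x₂ y₁ x₃) refl (σₙₘ x₂ y₁ ⊕ I x₃)) (y₂ + y₃))
      T₂ = I (x₁ + y₁) ⊕ τ x₂ x₃ y₂ y₃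
      -- both sides end by crossing x₂ over y₁ and x₃ over y₂ simultaneously
      K = (I x₁ ⊕ σₙₘ x₂ y₁) ⊕ (σₙₘ x₃ y₂ ⊕ I y₃)
      M₁≅N₁ : M₁ ≅ N₁
      M₁≅N₁ = ≅-trans (⊕≅ (I-split x₁ x₂) (≅-refl _))
               (≅-trans (⊕-rebracket (([I] x₁ ⊗ [I] x₂) ⊗ (([σ] x₃ y₁ ⊗ [I] y₂) ⊗ [I] y₃))
                                     ([I] x₁ ⊗ (([I] x₂ ⊗ [σ] x₃ y₁) ⊗ ([I] y₂ ⊗ [I] y₃))) refl)
                 (≅-trans (⊕≅ (≅-refl (I x₁)) (⊕≅ (≅-refl _) (⊕-id≅ y₂ y₃))) (≅-sym (cast≅ _ _ _))))
      M₂T₁≅K : (M₂ ⨾ T₁) ≅ K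
      M₂T₁≅K = begin
          M₂ ⨾ T₁
        ≅⟨ ⨾≅ (≅-trans (cast≅ _ _ _) (≅-trans (⊕≅ (I-split x₁ x₂) (⊕≅ (cast≅ _ _ _) (≅-refl (I y₃))))
                  (⊕-rebracket (([I] x₁ ⊗ [I] x₂) ⊗ (([I] y₁ ⊗ [σ] x₃ y₂) ⊗ [I] y₃))
                               (([I] x₁ ⊗ ([I] x₂ ⊗ [I] y₁)) ⊗ ([σ] x₃ y₂ ⊗ [I] y₃)) refl)))
              (≅-trans (⊕≅ (τ≅middle _ _ _ _) (I-split x₃ y₃))
                  (⊕-rebracket (([I] x₁ ⊗ ([σ] x₂ y₁ ⊗ [I] y₂)) ⊗ ([I] x₃ ⊗ [I] y₃))
                               (([I] x₁ ⊗ [σ] x₂ y₁) ⊗ (([I] y₂ ⊗ [I] x₃) ⊗ [I] y₃)) refl)) ⟩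
          ((I x₁ ⊕ (I x₂ ⊕ I y₁)) ⊕ (σₙₘ x₃ y₂ ⊕ I y₃))
            ⨾ ((I x₁ ⊕ σₙₘ x₂ y₁) ⊕ ((I y₂ ⊕ I x₃) ⊕ I y₃))
        ≅⟨ disjoint-⨾ˡ (⊕-idlike (≅-refl (I x₁)) (⊕-id≅ x₂ y₁))
                       (⊕-idlike (⊕-id≅ y₂ x₃) (≅-refl (I y₃))) ⟩
          K
        ∎
      N₂T₂≅K : (N₂ ⨾ T₂) ≅ K
      N₂T₂≅K = begin
          N₂ ⨾ T₂
        ≅⟨ ⨾≅ (≅-trans (cast≅ _ _ _) (≅-trans (⊕≅ (≅-refl (I x₁)) (⊕≅ (cast≅ _ _ _) (I-split y₂ y₃)))
                  (⊕-rebracket ([I] x₁ ⊗ (([σ] x₂ y₁ ⊗ [I] x₃) ⊗ ([I] y₂ ⊗ [I] y₃)))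
                               (([I] x₁ ⊗ [σ] x₂ y₁) ⊗ (([I] x₃ ⊗ [I] y₂) ⊗ [I] y₃)) refl)))
              (≅-trans (⊕≅ (I-split x₁ y₁) (τ≅middle _ _ _ _))
                  (⊕-rebracket (([I] x₁ ⊗ [I] y₁) ⊗ ([I] x₂ ⊗ ([σ] x₃ y₂ ⊗ [I] y₃)))
                               (([I] x₁ ⊗ ([I] y₁ ⊗ [I] x₂)) ⊗ ([σ] x₃ y₂ ⊗ [I] y₃)) refl)) ⟩
          ((I x₁ ⊕ σₙₘ x₂ y₁) ⊕ ((I x₃ ⊕ I y₂) ⊕ I y₃))
            ⨾ ((I x₁ ⊕ (I y₁ ⊕ I x₂)) ⊕ (σₙₘ x₃ y₂ ⊕ I y₃))
        ≅⟨ disjoint-⨾ʳ (⊕-idlike (⊕-id≅ x₃ y₂) (≅-refl (I y₃)))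
                       (⊕-idlike (≅-refl (I x₁)) (⊕-id≅ y₁ x₂)) ⟩
          K
        ∎

  τ-unzip-assoc : ∀ a a' b b' c c' →
                  ((I (a + a') ⊕ τ b b' c c') ⨾ τ a a' (b + c) (b' + c'))
                  ≅ ((τ a a' b b' ⊕ I (c + c')) ⨾ τ (a + b) (a' + b') c c')
  τ-unzip-assoc a a' b b' c c' = begin
      P ⨾ τ a a' (b + c) (b' + c')
    ≅⟨ ⨾≅ (≅-refl P) (≅-trans (τ≅middle _ _ _ _) (≅-trans (middle-split a _ _ (b' + c') (σ-hexagonʳ a' b c))
            (⨾≅ (≅-sym (cast≅ p₁ refl _)) (≅-refl _)))) ⟩
      P ⨾ (Q₁ ⨾ Q₂)
    ≅˘⟨ assoc≅ _ _ _ ⟩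
      (P ⨾ Q₁) ⨾ Q₂
    ≅⟨ ⨾≅ (≅-trans PQ₁≅K (≅-sym R₁R₂≅K)) (≅-trans Q₂≅K′ (≅-sym R₃≅K′)) ⟩
      (R₁ ⨾ R₂) ⨾ R₃
    ≅⟨ assoc≅ _ _ _ ⟩
      R₁ ⨾ (R₂ ⨾ R₃)
    ≅˘⟨ ⨾≅ (≅-refl R₁) (≅-trans (τ≅middle _ _ _ _) (≅-trans (middle-split (a + b) _ _ c' (σ-hexagonˡ a' b' c))
            (⨾≅ (≅-sym (cast≅ p₂ refl _)) (≅-refl _)))) ⟩
      R₁ ⨾ τ (a + b) (a' + b') c c'
    ∎
    where
      p₁ : a + (((a' + b) + c) + (b' + c')) ≡ (a + a') + ((b + c) + (b' + c'))
      p₁ = solve (a ∷ a' ∷ b ∷ b' ∷ c ∷ c' ∷ [])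
      p₂ : (a + b) + ((a' + (b' + c)) + c') ≡ ((a + b) + (a' + b')) + (c + c')
      p₂ = solve (a ∷ a' ∷ b ∷ b' ∷ c ∷ c' ∷ [])
      P  = I (a + a') ⊕ τ b b' c c'
      Q₁ = cast p₁ refl (middle a (σₙₘ a' b ⊕ I c) (b' + c'))
      Q₂ = middle a (cast (sym (+-assoc b a' c)) refl (I b ⊕ σₙₘ a' c)) (b' + c')
      R₁ = τ a a' b b' ⊕ I (c + c')
      R₂ = cast p₂ refl (middle (a + b) (I a' ⊕ σₙₘ b' c) c')
      R₃ = middle (a + b) (cast (+-assoc a' c b') refl (σₙₘ a' c ⊕ I b')) c'
      -- both sides begin by crossing a' over b and b' over c simultaneously,
      -- and end by crossing a' over c
      K  = (I a ⊕ σₙₘ a' b) ⊕ (σₙₘ b' c ⊕ I c')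
      K′ = ((I a ⊕ I b) ⊕ σₙₘ a' c) ⊕ (I b' ⊕ I c')
      PQ₁≅K : (P ⨾ Q₁) ≅ K
      PQ₁≅K = begin
          P ⨾ Q₁
        ≅⟨ ⨾≅ (≅-trans (⊕≅ (I-split a a') (τ≅middle _ _ _ _))
                 (⊕-rebracket (([I] a ⊗ [I] a') ⊗ ([I] b ⊗ ([σ] b' c ⊗ [I] c')))
                              (([I] a ⊗ ([I] a' ⊗ [I] b)) ⊗ ([σ] b' c ⊗ [I] c')) refl))
              (≅-trans (cast≅ _ _ _) (≅-trans (⊕≅ (≅-refl (I a)) (⊕≅ (≅-refl _) (I-split b' c')))
                 (⊕-rebracket ([I] a ⊗ (([σ] a' b ⊗ [I] c) ⊗ ([I] b' ⊗ [I] c')))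
                              (([I] a ⊗ [σ] a' b) ⊗ (([I] c ⊗ [I] b') ⊗ [I] c')) refl))) ⟩
          ((I a ⊕ (I a' ⊕ I b)) ⊕ (σₙₘ b' c ⊕ I c')) ⨾ ((I a ⊕ σₙₘ a' b) ⊕ ((I c ⊕ I b') ⊕ I c'))
        ≅⟨ disjoint-⨾ˡ (⊕-idlike (≅-refl (I a)) (⊕-id≅ a' b)) (⊕-idlike (⊕-id≅ c b') (≅-refl (I c'))) ⟩
          K
        ∎
      R₁R₂≅K : (R₁ ⨾ R₂) ≅ K
      R₁R₂≅K = begin
          R₁ ⨾ R₂
        ≅⟨ ⨾≅ (≅-trans (⊕≅ (τ≅middle _ _ _ _) (I-split c c'))
                 (⊕-rebracket (([I] a ⊗ ([σ] a' b ⊗ [I] b')) ⊗ ([I] c ⊗ [I] c'))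
                              (([I] a ⊗ [σ] a' b) ⊗ (([I] b' ⊗ [I] c) ⊗ [I] c')) refl))
              (≅-trans (cast≅ _ _ _) (≅-trans (⊕≅ (I-split a b) (≅-refl _))
                 (⊕-rebracket (([I] a ⊗ [I] b) ⊗ (([I] a' ⊗ [σ] b' c) ⊗ [I] c'))
                              (([I] a ⊗ ([I] b ⊗ [I] a')) ⊗ ([σ] b' c ⊗ [I] c')) refl))) ⟩
          ((I a ⊕ σₙₘ a' b) ⊕ ((I b' ⊕ I c) ⊕ I c')) ⨾ ((I a ⊕ (I b ⊕ I a')) ⊕ (σₙₘ b' c ⊕ I c'))
        ≅⟨ disjoint-⨾ʳ (⊕-idlike (⊕-id≅ b' c) (≅-refl (I c'))) (⊕-idlike (≅-refl (I a)) (⊕-id≅ b a')) ⟩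
          K
        ∎
      Q₂≅K′ : Q₂ ≅ K′
      Q₂≅K′ = ≅-trans (⊕≅ (≅-refl (I a)) (⊕≅ (cast≅ _ _ _) (I-split b' c')))
                (⊕-rebracket ([I] a ⊗ (([I] b ⊗ [σ] a' c) ⊗ ([I] b' ⊗ [I] c')))
                             ((([I] a ⊗ [I] b) ⊗ [σ] a' c) ⊗ ([I] b' ⊗ [I] c')) refl)
      R₃≅K′ : R₃ ≅ K′
      R₃≅K′ = ≅-trans (⊕≅ (I-split a b) (⊕≅ (cast≅ _ _ _) (≅-refl (I c'))))
                (⊕-rebracket (([I] a ⊗ [I] b) ⊗ (([σ] a' c ⊗ [I] b') ⊗ [I] c'))
                             ((([I] a ⊗ [I] b) ⊗ [σ] a' c) ⊗ ([I] b' ⊗ [I] c')) refl)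

  conjugate : ∀ {n₀ n₁ n₂ n₄ j j'}
                {X⁻ : Tm n₀ n₁} {X : Tm n₁ n₀} {P : Tm n₀ n₂} {Q : Tm n₁ n₄} {Y : Tm n₄ n₂} {Y⁻ : Tm n₂ n₄} →
              (X⁻ ⨾ X) ≅ I j → (Y ⨾ Y⁻) ≅ I j' → (X ⨾ P) ≅ (Q ⨾ Y) → (P ⨾ Y⁻) ≅ (X⁻ ⨾ Q)
  conjugate {X⁻ = X⁻} {X} {P} {Q} {Y} {Y⁻} X⁻X≅I YY⁻≅I XP≅QY = begin
      P ⨾ Y⁻
    ≅˘⟨ absorbˡ X⁻X≅I _ ⟩
      (X⁻ ⨾ X) ⨾ (P ⨾ Y⁻)
    ≅⟨ regroup₄ _ _ _ _ ⟩
      X⁻ ⨾ ((X ⨾ P) ⨾ Y⁻)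
    ≅⟨ ⨾≅ (≅-refl X⁻) (⨾≅ XP≅QY (≅-refl Y⁻)) ⟩
      X⁻ ⨾ ((Q ⨾ Y) ⨾ Y⁻)
    ≅⟨ ⨾≅ (≅-refl X⁻) (≅-trans (assoc≅ _ _ _) (absorbʳ YY⁻≅I Q)) ⟩
      X⁻ ⨾ Q
    ∎

  -- τ-zip-assoc with the outer interchanges moved across; these are the
  -- coherences behind the two Frobenius laws of a ⊕ of Frobenius monoids
  τ-frobeniusˡ : ∀ x₁ x₂ y₁ y₂ x₃ y₃ →
                 ((τ x₁ x₂ y₁ y₂ ⊕ I (x₃ + y₃))
                    ⨾ cast (sym (+-assoc (x₁ + y₁) (x₂ + y₂) (x₃ + y₃))) refl (I (x₁ + y₁) ⊕ τ x₂ y₂ x₃ y₃))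
                 ≅ (τ (x₁ + x₂) (y₁ + y₂) x₃ y₃
                      ⨾ cast (+-shuffle₆ x₁ x₂ x₃ y₁ y₂ y₃) refl (τ x₁ (x₂ + x₃) y₁ (y₂ + y₃)))
  τ-frobeniusˡ x₁ x₂ y₁ y₂ x₃ y₃ =
    conjugate (τ-inverse (x₁ + x₂) (y₁ + y₂) x₃ y₃)
      (≅-trans (⨾≅ (cast≅ _ _ _) (cast≅ _ _ _)) (I⊕-inverse (x₁ + y₁) (τ-inverse x₂ x₃ y₂ y₃)))
      (≅-trans (τ-zip-assoc x₁ x₂ x₃ y₁ y₂ y₃)
        (⨾≅ (≅-sym (cast≅ (+-shuffle₆ x₁ x₂ x₃ y₁ y₂ y₃) refl (τ x₁ (x₂ + x₃) y₁ (y₂ + y₃))))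
            (≅-sym (cast≅ refl (sym (+-assoc (x₁ + y₁) (x₂ + y₂) (x₃ + y₃))) _))))

  τ-frobeniusʳ : ∀ x₁ y₁ x₂ x₃ y₂ y₃ →
                 ((I (x₁ + y₁) ⊕ τ x₂ x₃ y₂ y₃)
                    ⨾ cast (+-assoc (x₁ + y₁) (x₂ + y₂) (x₃ + y₃)) refl (τ x₁ y₁ x₂ y₂ ⊕ I (x₃ + y₃)))
                 ≅ (τ x₁ y₁ (x₂ + x₃) (y₂ + y₃)
                      ⨾ cast (sym (+-shuffle₆ x₁ x₂ x₃ y₁ y₂ y₃)) refl (τ (x₁ + x₂) x₃ (y₁ + y₂) y₃))
  τ-frobeniusʳ x₁ y₁ x₂ x₃ y₂ y₃ =
    conjugate (τ-inverse x₁ y₁ (x₂ + x₃) (y₂ + y₃))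
      (≅-trans (⨾≅ (cast≅ _ _ _) (cast≅ _ _ _)) (⊕I-inverse (x₃ + y₃) (τ-inverse x₁ x₂ y₁ y₂)))
      (≅-trans (≅-sym (τ-zip-assoc x₁ x₂ x₃ y₁ y₂ y₃))
        (⨾≅ (≅-sym (cast≅ (sym (+-shuffle₆ x₁ x₂ x₃ y₁ y₂ y₃)) refl (τ (x₁ + x₂) x₃ (y₁ + y₂) y₃)))
            (≅-sym (cast≅ refl (+-assoc (x₁ + y₁) (x₂ + y₂) (x₃ + y₃)) _))))

-- The remaining
-- inequality  I a ≤ D ⨾ M  follows from  D⨾M≅I.
module Frobenius {S : Signature} where
  open Hetero {S}
  open Symmetry {S}
  open MiddleFour {S}
  open ≅-Reasoning

  record SCFB (a : ℕ) : Set where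
    field
      D : Tm a (a + a)
      E : Tm a 0
      M : Tm (a + a) a
      U : Tm 0 a
      D-assoc    : (D ⨾ (D ⊕ I a)) ≅ (D ⨾ (I a ⊕ D))
      D-unit     : (D ⨾ (E ⊕ I a)) ≅ I a
      D-comm     : (D ⨾ σₙₘ a a) ≅ D
      M-assoc    : ((M ⊕ I a) ⨾ M) ≅ ((I a ⊕ M) ⨾ M)
      M-unit     : ((U ⊕ I a) ⨾ M) ≅ I a
      M-comm     : (σₙₘ a a ⨾ M) ≅ M
      frobeniusˡ : ((D ⊕ I a) ⨾ cast (sym (+-assoc a a a)) refl (I a ⊕ M)) ≅ (M ⨾ D)
      frobeniusʳ : ((I a ⊕ D) ⨾ cast (+-assoc a a a) refl (M ⊕ I a)) ≅ (M ⨾ D)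
      D⨾M≅I      : (D ⨾ M) ≅ I a
      adj-E₁     : I a ≲ (E ⨾ U)
      adj-E₂     : (U ⨾ E) ≲ I 0
      adj-D₂     : (M ⨾ D) ≲ I (a + a)

  SCFB-one : SCFB 1
  SCFB-one = record
    { D = δ ; E = ε ; M = μ ; U = η
    ; D-assoc    = ≅-trans (⨾≅ (≅-refl δ) (⊕≅ (≅-refl δ) (≅-sym id₁≅I)))
                     (≅-trans (axiom≅ δ-assoc) (⨾≅ (≅-refl δ) (⊕≅ id₁≅I (≅-refl δ))))
    ; D-unit     = ≅-trans (⨾≅ (≅-refl δ) (⊕≅ (≅-refl ε) (≅-sym id₁≅I))) (≅-trans (axiom≅ δ-unit) id₁≅I)
    ; D-comm     = ≅-trans (⨾≅ (≅-refl δ) σ-one-one) (axiom≅ δ-comm)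
    ; M-assoc    = ≅-trans (⨾≅ (⊕≅ (≅-refl μ) (≅-sym id₁≅I)) (≅-refl μ))
                     (≅-trans (axiom≅ μ-assoc) (⨾≅ (⊕≅ id₁≅I (≅-refl μ)) (≅-refl μ)))
    ; M-unit     = ≅-trans (⨾≅ (⊕≅ (≅-refl η) (≅-sym id₁≅I)) (≅-refl μ)) (≅-trans (axiom≅ μ-unit) id₁≅I)
    ; M-comm     = ≅-trans (⨾≅ σ-one-one (≅-refl μ)) (axiom≅ μ-comm)
    ; frobeniusˡ = ≅-trans (⨾≅ (⊕≅ (≅-refl δ) (≅-sym id₁≅I))
                              (≅-trans (cast≅ _ _ _) (⊕≅ (≅-sym id₁≅I) (≅-refl μ))))
                     (axiom≅ frob₁)
    ; frobeniusʳ = ≅-trans (⨾≅ (⊕≅ (≅-sym id₁≅I) (≅-refl δ))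
                              (≅-trans (cast≅ _ _ _) (⊕≅ (≅-refl μ) (≅-sym id₁≅I))))
                     (≅-sym (axiom≅ frob₂))
    ; D⨾M≅I      = ≅-trans (axiom≅ special) id₁≅I
    ; adj-E₁     = ≲-trans (proj₂ id₁≅I) (≤⇒≲ (by-I adj-ε₁))
    ; adj-E₂     = ≤⇒≲ (by-I adj-ε₂)
    ; adj-D₂     = ≤⇒≲ (by-I adj-δ₂)
    }

  SCFB-zero : SCFB 0
  SCFB-zero = record
    { D = id₀ ; E = id₀ ; M = id₀ ; U = id₀
    ; D-assoc    = idlike-unique (⨾-idlike id₀≅I id₀⊕id₀≅I) (⨾-idlike id₀≅I id₀⊕id₀≅I)
    ; D-unit     = ⨾-idlike id₀≅I id₀⊕id₀≅I
    ; D-comm     = ≅-trans (absorbˡ id₀≅I _) (σ-zeroˡ 0)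
    ; M-assoc    = idlike-unique (⨾-idlike id₀⊕id₀≅I id₀≅I) (⨾-idlike id₀⊕id₀≅I id₀≅I)
    ; M-unit     = ⨾-idlike id₀⊕id₀≅I id₀≅I
    ; M-comm     = absorbʳ id₀≅I _
    ; frobeniusˡ = idlike-unique (⨾-idlike id₀⊕id₀≅I (≅-trans (cast≅ _ _ _) id₀⊕id₀≅I)) id₀⨾id₀≅I
    ; frobeniusʳ = idlike-unique (⨾-idlike id₀⊕id₀≅I (≅-trans (cast≅ _ _ _) id₀⊕id₀≅I)) id₀⨾id₀≅I
    ; D⨾M≅I      = id₀⨾id₀≅I
    ; adj-E₁     = proj₂ id₀⨾id₀≅I
    ; adj-E₂     = proj₁ id₀⨾id₀≅I
    ; adj-D₂     = proj₁ id₀⨾id₀≅I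
    }
    where
      id₀⨾id₀≅I : (id₀ ⨾ id₀) ≅ I 0
      id₀⨾id₀≅I = idˡ≅ id₀
      id₀≅I : id₀ ≅ I 0
      id₀≅I = ≅-refl id₀
      id₀⊕id₀≅I : (id₀ ⊕ id₀) ≅ I 0
      id₀⊕id₀≅I = ⊕-unitˡ≅ id₀

  module Sum {a b} (A : SCFB a) (B : SCFB b) where
    open SCFB A renaming (D to Da; E to Ea; M to Ma; U to Ua)
    open SCFB B renaming (D to Db; E to Eb; M to Mb; U to Ub)

    T  = τ a a b b
    T′ = τ a b a b

    D' : Tm (a + b) ((a + b) + (a + b))
    D' = (Da ⊕ Db) ⨾ T
    E' : Tm (a + b) 0
    E' = Ea ⊕ Eb
    M' : Tm ((a + b) + (a + b)) (a + b)
    M' = T′ ⨾ (Ma ⊕ Mb)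
    U' : Tm 0 (a + b)
    U' = Ua ⊕ Ub

    D'-layer : ∀ {a₁ a₂ b₁ b₂} (f : Tm a a₁) (g : Tm b b₁) (h : Tm a a₂) (k : Tm b b₂) →
               (D' ⨾ ((f ⊕ g) ⊕ (h ⊕ k))) ≅ (((Da ⨾ (f ⊕ h)) ⊕ (Db ⨾ (g ⊕ k))) ⨾ τ a₁ a₂ b₁ b₂)
    D'-layer {a₁} {a₂} {b₁} {b₂} f g h k = begin
        ((Da ⊕ Db) ⨾ T) ⨾ ((f ⊕ g) ⊕ (h ⊕ k))
      ≅⟨ assoc≅ _ _ _ ⟩
        (Da ⊕ Db) ⨾ (T ⨾ ((f ⊕ g) ⊕ (h ⊕ k)))
      ≅˘⟨ ⨾≅ (≅-refl _) (τ-natural f h g k) ⟩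
        (Da ⊕ Db) ⨾ (((f ⊕ h) ⊕ (g ⊕ k)) ⨾ τ a₁ a₂ b₁ b₂)
      ≅˘⟨ assoc≅ _ _ _ ⟩
        ((Da ⊕ Db) ⨾ ((f ⊕ h) ⊕ (g ⊕ k))) ⨾ τ a₁ a₂ b₁ b₂
      ≅˘⟨ ⨾≅ (interchange≅ _ _ _ _) (≅-refl _) ⟩
        ((Da ⨾ (f ⊕ h)) ⊕ (Db ⨾ (g ⊕ k))) ⨾ τ a₁ a₂ b₁ b₂
      ∎

    M'-layer : ∀ {a₁ a₂ b₁ b₂} (f : Tm a₁ a) (g : Tm b₁ b) (h : Tm a₂ a) (k : Tm b₂ b) →
               (((f ⊕ g) ⊕ (h ⊕ k)) ⨾ M') ≅ (τ a₁ b₁ a₂ b₂ ⨾ (((f ⊕ h) ⨾ Ma) ⊕ ((g ⊕ k) ⨾ Mb)))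
    M'-layer {a₁} {a₂} {b₁} {b₂} f g h k = begin
        ((f ⊕ g) ⊕ (h ⊕ k)) ⨾ (T′ ⨾ (Ma ⊕ Mb))
      ≅˘⟨ assoc≅ _ _ _ ⟩
        (((f ⊕ g) ⊕ (h ⊕ k)) ⨾ T′) ⨾ (Ma ⊕ Mb)
      ≅⟨ ⨾≅ (τ-natural f g h k) (≅-refl _) ⟩
        (τ a₁ b₁ a₂ b₂ ⨾ ((f ⊕ h) ⊕ (g ⊕ k))) ⨾ (Ma ⊕ Mb)
      ≅⟨ assoc≅ _ _ _ ⟩
        τ a₁ b₁ a₂ b₂ ⨾ (((f ⊕ h) ⊕ (g ⊕ k)) ⨾ (Ma ⊕ Mb))
      ≅˘⟨ ⨾≅ (≅-refl _) (interchange≅ _ _ _ _) ⟩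
        τ a₁ b₁ a₂ b₂ ⨾ (((f ⊕ h) ⨾ Ma) ⊕ ((g ⊕ k) ⨾ Mb))
      ∎

    M'⨾D' : (M' ⨾ D') ≅ (T′ ⨾ (((Ma ⨾ Da) ⊕ (Mb ⨾ Db)) ⨾ T))
    M'⨾D' = ≅-trans (regroup₄ _ _ _ _) (⨾≅ (≅-refl T′) (⨾≅ (≅-sym (interchange≅ _ _ _ _)) (≅-refl T)))

    ⊕I-layer₁ : ∀ {n z m} (x : Tm n z) (y : Tm z m) →
                ((x ⨾ y) ⊕ I (a + b)) ≅ ((x ⊕ (I a ⊕ I b)) ⨾ (y ⊕ I (a + b)))
    ⊕I-layer₁ x y = ≅-trans (⊕I-split (a + b) x y) (⨾≅ (⊕≅ (≅-refl x) (I-split a b)) (≅-refl _))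

    ⊕I-layer₂ : ∀ {n z m} (x : Tm n z) (y : Tm z m) →
                ((x ⨾ y) ⊕ I (a + b)) ≅ ((x ⊕ I (a + b)) ⨾ (y ⊕ (I a ⊕ I b)))
    ⊕I-layer₂ x y = ≅-trans (⊕I-split (a + b) x y) (⨾≅ (≅-refl _) (⊕≅ (≅-refl y) (I-split a b)))

    I⊕-layer₁ : ∀ {n z m} (x : Tm n z) (y : Tm z m) →
                (I (a + b) ⊕ (x ⨾ y)) ≅ (((I a ⊕ I b) ⊕ x) ⨾ (I (a + b) ⊕ y))
    I⊕-layer₁ x y = ≅-trans (I⊕-split (a + b) x y) (⨾≅ (⊕≅ (I-split a b) (≅-refl x)) (≅-refl _))

    I⊕-layer₂ : ∀ {n z m} (x : Tm n z) (y : Tm z m) →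
                (I (a + b) ⊕ (x ⨾ y)) ≅ ((I (a + b) ⊕ x) ⨾ ((I a ⊕ I b) ⊕ y))
    I⊕-layer₂ x y = ≅-trans (I⊕-split (a + b) x y) (⨾≅ (≅-refl _) (⊕≅ (I-split a b) (≅-refl y)))

    D'-assoc : (D' ⨾ (D' ⊕ I (a + b))) ≅ (D' ⨾ (I (a + b) ⊕ D'))
    D'-assoc = begin
        D' ⨾ (D' ⊕ I (a + b))
      ≅⟨ ⨾≅ (≅-refl D') (⊕I-layer₁ _ _) ⟩
        D' ⨾ (((Da ⊕ Db) ⊕ (I a ⊕ I b)) ⨾ (T ⊕ I (a + b)))
      ≅˘⟨ assoc≅ _ _ _ ⟩
        (D' ⨾ ((Da ⊕ Db) ⊕ (I a ⊕ I b))) ⨾ (T ⊕ I (a + b))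
      ≅⟨ ⨾≅ (D'-layer Da Db (I a) (I b)) (≅-refl _) ⟩
        (((Da ⨾ (Da ⊕ I a)) ⊕ (Db ⨾ (Db ⊕ I b))) ⨾ τ (a + a) a (b + b) b) ⨾ (T ⊕ I (a + b))
      ≅⟨ assoc≅ _ _ _ ⟩
        ((Da ⨾ (Da ⊕ I a)) ⊕ (Db ⨾ (Db ⊕ I b))) ⨾ (τ (a + a) a (b + b) b ⨾ (T ⊕ I (a + b)))
      ≅⟨ ⨾≅ (⊕≅ (SCFB.D-assoc A) (SCFB.D-assoc B)) (τ-zip-assoc a a a b b b) ⟩
        ((Da ⨾ (I a ⊕ Da)) ⊕ (Db ⨾ (I b ⊕ Db))) ⨾ (τ a (a + a) b (b + b) ⨾ (I (a + b) ⊕ T))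
      ≅˘⟨ assoc≅ _ _ _ ⟩
        (((Da ⨾ (I a ⊕ Da)) ⊕ (Db ⨾ (I b ⊕ Db))) ⨾ τ a (a + a) b (b + b)) ⨾ (I (a + b) ⊕ T)
      ≅˘⟨ ⨾≅ (D'-layer (I a) (I b) Da Db) (≅-refl _) ⟩
        (D' ⨾ ((I a ⊕ I b) ⊕ (Da ⊕ Db))) ⨾ (I (a + b) ⊕ T)
      ≅⟨ assoc≅ _ _ _ ⟩
        D' ⨾ (((I a ⊕ I b) ⊕ (Da ⊕ Db)) ⨾ (I (a + b) ⊕ T))
      ≅˘⟨ ⨾≅ (≅-refl D') (I⊕-layer₁ _ _) ⟩
        D' ⨾ (I (a + b) ⊕ D')
      ∎

    M'-assoc : ((M' ⊕ I (a + b)) ⨾ M') ≅ ((I (a + b) ⊕ M') ⨾ M')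
    M'-assoc = begin
        (M' ⊕ I (a + b)) ⨾ M'
      ≅⟨ ⨾≅ (⊕I-layer₂ _ _) (≅-refl M') ⟩
        ((T′ ⊕ I (a + b)) ⨾ ((Ma ⊕ Mb) ⊕ (I a ⊕ I b))) ⨾ M'
      ≅⟨ assoc≅ _ _ _ ⟩
        (T′ ⊕ I (a + b)) ⨾ (((Ma ⊕ Mb) ⊕ (I a ⊕ I b)) ⨾ M')
      ≅⟨ ⨾≅ (≅-refl _) (M'-layer Ma Mb (I a) (I b)) ⟩
        (T′ ⊕ I (a + b)) ⨾ (τ (a + a) (b + b) a b ⨾ (((Ma ⊕ I a) ⨾ Ma) ⊕ ((Mb ⊕ I b) ⨾ Mb)))
      ≅˘⟨ assoc≅ _ _ _ ⟩
        ((T′ ⊕ I (a + b)) ⨾ τ (a + a) (b + b) a b) ⨾ (((Ma ⊕ I a) ⨾ Ma) ⊕ ((Mb ⊕ I b) ⨾ Mb))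
      ≅⟨ ⨾≅ (≅-sym (τ-unzip-assoc a b a b a b)) (⊕≅ (SCFB.M-assoc A) (SCFB.M-assoc B)) ⟩
        ((I (a + b) ⊕ T′) ⨾ τ a b (a + a) (b + b)) ⨾ (((I a ⊕ Ma) ⨾ Ma) ⊕ ((I b ⊕ Mb) ⨾ Mb))
      ≅⟨ assoc≅ _ _ _ ⟩
        (I (a + b) ⊕ T′) ⨾ (τ a b (a + a) (b + b) ⨾ (((I a ⊕ Ma) ⨾ Ma) ⊕ ((I b ⊕ Mb) ⨾ Mb)))
      ≅˘⟨ ⨾≅ (≅-refl _) (M'-layer (I a) (I b) Ma Mb) ⟩
        (I (a + b) ⊕ T′) ⨾ (((I a ⊕ I b) ⊕ (Ma ⊕ Mb)) ⨾ M')
      ≅˘⟨ assoc≅ _ _ _ ⟩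
        ((I (a + b) ⊕ T′) ⨾ ((I a ⊕ I b) ⊕ (Ma ⊕ Mb))) ⨾ M'
      ≅˘⟨ ⨾≅ (I⊕-layer₂ _ _) (≅-refl M') ⟩
        (I (a + b) ⊕ M') ⨾ M'
      ∎

    D'-unit : (D' ⨾ (E' ⊕ I (a + b))) ≅ I (a + b)
    D'-unit = begin
        D' ⨾ ((Ea ⊕ Eb) ⊕ I (a + b))
      ≅⟨ ⨾≅ (≅-refl D') (⊕≅ (≅-refl _) (I-split a b)) ⟩
        D' ⨾ ((Ea ⊕ Eb) ⊕ (I a ⊕ I b))
      ≅⟨ D'-layer Ea Eb (I a) (I b) ⟩
        ((Da ⨾ (Ea ⊕ I a)) ⊕ (Db ⨾ (Eb ⊕ I b))) ⨾ τ 0 a 0 b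
      ≅⟨ ⨾-idlike (⊕-idlike (SCFB.D-unit A) (SCFB.D-unit B)) (τ-trivial a b) ⟩
        I (a + b)
      ∎

    M'-unit : ((U' ⊕ I (a + b)) ⨾ M') ≅ I (a + b)
    M'-unit = begin
        ((Ua ⊕ Ub) ⊕ I (a + b)) ⨾ M'
      ≅⟨ ⨾≅ (⊕≅ (≅-refl _) (I-split a b)) (≅-refl M') ⟩
        ((Ua ⊕ Ub) ⊕ (I a ⊕ I b)) ⨾ M'
      ≅⟨ M'-layer Ua Ub (I a) (I b) ⟩
        τ 0 0 a b ⨾ (((Ua ⊕ I a) ⨾ Ma) ⊕ ((Ub ⊕ I b) ⨾ Mb))
      ≅⟨ ⨾-idlike (τ-trivial′ a b) (⊕-idlike (SCFB.M-unit A) (SCFB.M-unit B)) ⟩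
        I (a + b)
      ∎

    D'-comm : (D' ⨾ σₙₘ (a + b) (a + b)) ≅ D'
    D'-comm = begin
        ((Da ⊕ Db) ⨾ T) ⨾ σₙₘ (a + b) (a + b)
      ≅⟨ assoc≅ _ _ _ ⟩
        (Da ⊕ Db) ⨾ (T ⨾ σₙₘ (a + b) (a + b))
      ≅⟨ ⨾≅ (≅-refl _) (τ-σ a b a b) ⟩
        (Da ⊕ Db) ⨾ ((σₙₘ a a ⊕ σₙₘ b b) ⨾ T)
      ≅˘⟨ assoc≅ _ _ _ ⟩
        ((Da ⊕ Db) ⨾ (σₙₘ a a ⊕ σₙₘ b b)) ⨾ T
      ≅˘⟨ ⨾≅ (interchange≅ _ _ _ _) (≅-refl T) ⟩
        ((Da ⨾ σₙₘ a a) ⊕ (Db ⨾ σₙₘ b b)) ⨾ T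
      ≅⟨ ⨾≅ (⊕≅ (SCFB.D-comm A) (SCFB.D-comm B)) (≅-refl T) ⟩
        D'
      ∎

    M'-comm : (σₙₘ (a + b) (a + b) ⨾ M') ≅ M'
    M'-comm = begin
        σₙₘ (a + b) (a + b) ⨾ (T′ ⨾ (Ma ⊕ Mb))
      ≅˘⟨ assoc≅ _ _ _ ⟩
        (σₙₘ (a + b) (a + b) ⨾ T′) ⨾ (Ma ⊕ Mb)
      ≅⟨ ⨾≅ (σ-τ a b a b) (≅-refl _) ⟩
        (T′ ⨾ (σₙₘ a a ⊕ σₙₘ b b)) ⨾ (Ma ⊕ Mb)
      ≅⟨ assoc≅ _ _ _ ⟩
        T′ ⨾ ((σₙₘ a a ⊕ σₙₘ b b) ⨾ (Ma ⊕ Mb))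
      ≅˘⟨ ⨾≅ (≅-refl T′) (interchange≅ _ _ _ _) ⟩
        T′ ⨾ ((σₙₘ a a ⨾ Ma) ⊕ (σₙₘ b b ⨾ Mb))
      ≅⟨ ⨾≅ (≅-refl T′) (⊕≅ (SCFB.M-comm A) (SCFB.M-comm B)) ⟩
        M'
      ∎

    D'⨾M'≅I : (D' ⨾ M') ≅ I (a + b)
    D'⨾M'≅I = begin
        ((Da ⊕ Db) ⨾ T) ⨾ (T′ ⨾ (Ma ⊕ Mb))
      ≅⟨ regroup₄ _ _ _ _ ⟩
        (Da ⊕ Db) ⨾ ((T ⨾ T′) ⨾ (Ma ⊕ Mb))
      ≅⟨ ⨾≅ (≅-refl _) (absorbˡ (τ-inverse a a b b) _) ⟩
        (Da ⊕ Db) ⨾ (Ma ⊕ Mb)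
      ≅˘⟨ interchange≅ _ _ _ _ ⟩
        (Da ⨾ Ma) ⊕ (Db ⨾ Mb)
      ≅⟨ ⊕-idlike (SCFB.D⨾M≅I A) (SCFB.D⨾M≅I B) ⟩
        I (a + b)
      ∎

    frobeniusˡ′ : ((D' ⊕ I (a + b)) ⨾ cast (sym (+-assoc (a + b) (a + b) (a + b))) refl (I (a + b) ⊕ M'))
                  ≅ (M' ⨾ D')
    frobeniusˡ′ = begin
        (D' ⊕ I (a + b)) ⨾ cast p refl (I (a + b) ⊕ M')
      ≅⟨ ⨾≅ (⊕I-layer₁ _ _)
            (≅-trans (cast≅ _ _ _) (≅-trans (I⊕-layer₂ _ _) (⨾≅ (≅-sym (cast≅ p refl _)) (≅-refl _)))) ⟩
        (A₁ ⨾ (T ⊕ I (a + b))) ⨾ (cast p refl (I (a + b) ⊕ T′) ⨾ A₂)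
      ≅⟨ regroup₄ _ _ _ _ ⟩
        A₁ ⨾ (((T ⊕ I (a + b)) ⨾ cast p refl (I (a + b) ⊕ T′)) ⨾ A₂)
      ≅⟨ ⨾≅ (≅-refl A₁) (⨾≅ (τ-frobeniusˡ a a b b a b) (≅-refl A₂)) ⟩
        A₁ ⨾ ((τ (a + a) (b + b) a b ⨾ cast q refl (τ a (a + a) b (b + b))) ⨾ A₂)
      ≅˘⟨ regroup₄ _ _ _ _ ⟩
        (A₁ ⨾ τ (a + a) (b + b) a b) ⨾ (cast q refl (τ a (a + a) b (b + b)) ⨾ A₂)
      ≅⟨ ⨾≅ (τ-natural Da Db (I a) (I b))
            (≅-trans (⨾≅ (cast≅ q refl _) (≅-refl A₂))
              (≅-trans (≅-sym (τ-natural (I a) Ma (I b) Mb))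
                (⨾≅ (⊕≅ (≅-sym (cast≅ (sym (+-assoc a a a)) refl _))
                        (≅-sym (cast≅ (sym (+-assoc b b b)) refl _))) (≅-refl T)))) ⟩
        (T′ ⨾ ((Da ⊕ I a) ⊕ (Db ⊕ I b))) ⨾ ((Ca ⊕ Cb) ⨾ T)
      ≅⟨ regroup₄ _ _ _ _ ⟩
        T′ ⨾ ((((Da ⊕ I a) ⊕ (Db ⊕ I b)) ⨾ (Ca ⊕ Cb)) ⨾ T)
      ≅˘⟨ ⨾≅ (≅-refl T′) (⨾≅ (interchange≅ _ _ _ _) (≅-refl T)) ⟩
        T′ ⨾ ((((Da ⊕ I a) ⨾ Ca) ⊕ ((Db ⊕ I b) ⨾ Cb)) ⨾ T)
      ≅⟨ ⨾≅ (≅-refl T′) (⨾≅ (⊕≅ (SCFB.frobeniusˡ A) (SCFB.frobeniusˡ B)) (≅-refl T)) ⟩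
        T′ ⨾ (((Ma ⨾ Da) ⊕ (Mb ⨾ Db)) ⨾ T)
      ≅˘⟨ M'⨾D' ⟩
        M' ⨾ D'
      ∎
      where
        p = sym (+-assoc (a + b) (a + b) (a + b))
        q = +-shuffle₆ a a a b b b
        A₁ = (Da ⊕ Db) ⊕ (I a ⊕ I b)
        A₂ = (I a ⊕ I b) ⊕ (Ma ⊕ Mb)
        Ca = cast (sym (+-assoc a a a)) refl (I a ⊕ Ma)
        Cb = cast (sym (+-assoc b b b)) refl (I b ⊕ Mb)

    frobeniusʳ′ : ((I (a + b) ⊕ D') ⨾ cast (+-assoc (a + b) (a + b) (a + b)) refl (M' ⊕ I (a + b)))
                  ≅ (M' ⨾ D')
    frobeniusʳ′ = begin
        (I (a + b) ⊕ D') ⨾ cast p refl (M' ⊕ I (a + b))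
      ≅⟨ ⨾≅ (I⊕-layer₁ _ _)
            (≅-trans (cast≅ _ _ _) (≅-trans (⊕I-layer₂ _ _) (⨾≅ (≅-sym (cast≅ p refl _)) (≅-refl _)))) ⟩
        (A₁ ⨾ (I (a + b) ⊕ T)) ⨾ (cast p refl (T′ ⊕ I (a + b)) ⨾ A₂)
      ≅⟨ regroup₄ _ _ _ _ ⟩
        A₁ ⨾ (((I (a + b) ⊕ T) ⨾ cast p refl (T′ ⊕ I (a + b))) ⨾ A₂)
      ≅⟨ ⨾≅ (≅-refl A₁) (⨾≅ (τ-frobeniusʳ a b a a b b) (≅-refl A₂)) ⟩
        A₁ ⨾ ((τ a b (a + a) (b + b) ⨾ cast q refl (τ (a + a) a (b + b) b)) ⨾ A₂)
      ≅˘⟨ regroup₄ _ _ _ _ ⟩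
        (A₁ ⨾ τ a b (a + a) (b + b)) ⨾ (cast q refl (τ (a + a) a (b + b) b) ⨾ A₂)
      ≅⟨ ⨾≅ (τ-natural (I a) (I b) Da Db)
            (≅-trans (⨾≅ (cast≅ q refl _) (≅-refl A₂))
              (≅-trans (≅-sym (τ-natural Ma (I a) Mb (I b)))
                (⨾≅ (⊕≅ (≅-sym (cast≅ (+-assoc a a a) refl _))
                        (≅-sym (cast≅ (+-assoc b b b) refl _))) (≅-refl T)))) ⟩
        (T′ ⨾ ((I a ⊕ Da) ⊕ (I b ⊕ Db))) ⨾ ((Ca ⊕ Cb) ⨾ T)
      ≅⟨ regroup₄ _ _ _ _ ⟩
        T′ ⨾ ((((I a ⊕ Da) ⊕ (I b ⊕ Db)) ⨾ (Ca ⊕ Cb)) ⨾ T)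
      ≅˘⟨ ⨾≅ (≅-refl T′) (⨾≅ (interchange≅ _ _ _ _) (≅-refl T)) ⟩
        T′ ⨾ ((((I a ⊕ Da) ⨾ Ca) ⊕ ((I b ⊕ Db) ⨾ Cb)) ⨾ T)
      ≅⟨ ⨾≅ (≅-refl T′) (⨾≅ (⊕≅ (SCFB.frobeniusʳ A) (SCFB.frobeniusʳ B)) (≅-refl T)) ⟩
        T′ ⨾ (((Ma ⨾ Da) ⊕ (Mb ⨾ Db)) ⨾ T)
      ≅˘⟨ M'⨾D' ⟩
        M' ⨾ D'
      ∎
      where
        p = +-assoc (a + b) (a + b) (a + b)
        q = sym (+-shuffle₆ a a a b b b)
        A₁ = (I a ⊕ I b) ⊕ (Da ⊕ Db)
        A₂ = (Ma ⊕ Mb) ⊕ (I a ⊕ I b)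
        Ca = cast (+-assoc a a a) refl (Ma ⊕ I a)
        Cb = cast (+-assoc b b b) refl (Mb ⊕ I b)

    adj-E₁′ : I (a + b) ≲ (E' ⨾ U')
    adj-E₁′ = ≲-trans (proj₁ (I-split a b))
                (≲-trans (⊕≲ (SCFB.adj-E₁ A) (SCFB.adj-E₁ B)) (proj₁ (interchange≅ Ea Ua Eb Ub)))

    adj-E₂′ : (U' ⨾ E') ≲ I 0
    adj-E₂′ = ≲-trans (proj₂ (interchange≅ Ua Ea Ub Eb))
                (≲-trans (⊕≲ (SCFB.adj-E₂ A) (SCFB.adj-E₂ B)) (proj₁ (⊕-unitˡ≅ id₀)))

    adj-D₂′ : (M' ⨾ D') ≲ I ((a + b) + (a + b))
    adj-D₂′ = begin≲
        M' ⨾ D'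
      ≈⟨ M'⨾D' ⟩
        T′ ⨾ (((Ma ⨾ Da) ⊕ (Mb ⨾ Db)) ⨾ T)
      ≤⟨ ⨾≲ (≲-refl T′) (⨾≲ (⊕≲ (SCFB.adj-D₂ A) (SCFB.adj-D₂ B)) (≲-refl T)) ⟩
        T′ ⨾ ((I (a + a) ⊕ I (b + b)) ⨾ T)
      ≈⟨ ⨾≅ (≅-refl T′) (absorbˡ (⊕-id≅ _ _) T) ⟩
        T′ ⨾ T
      ≈⟨ τ-inverse a b a b ⟩
        I ((a + b) + (a + b))
      ∎≲
      where open ≲-Reasoning

    SCFB-⊕ : SCFB (a + b)
    SCFB-⊕ = record
      { D = D' ; E = E' ; M = M' ; U = U'
      ; D-assoc = D'-assoc ; D-unit = D'-unit ; D-comm = D'-comm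
      ; M-assoc = M'-assoc ; M-unit = M'-unit ; M-comm = M'-comm
      ; frobeniusˡ = frobeniusˡ′ ; frobeniusʳ = frobeniusʳ′ ; D⨾M≅I = D'⨾M'≅I
      ; adj-E₁ = adj-E₁′ ; adj-E₂ = adj-E₂′ ; adj-D₂ = adj-D₂′
      }

  open Sum using (SCFB-⊕) public

-- By induction on R: the constants are checked
-- directly, the generators of Σ are the inequalities (I) (as δⁿ ≅ δₙ and
-- εⁿ = εₙ), and ⨾, ⊕ preserve laxness, using that δⁿ on a sum is the ⊕
-- of the δⁿ's followed by a middle-four interchange.
module LaxHomomorphism {S : Signature} where
  open Hetero {S}
  open Symmetry {S}
  open MiddleFour {S}
  open Frobenius {S}
  open ≅-Reasoning

  -- every object n = 1 + (1 + ... + 0) carries the structure; it is kept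
  -- abstract so that only the facts below are used about it
  abstract
    SCFB-ℕ : ∀ n → SCFB n
    SCFB-ℕ zero    = SCFB-zero
    SCFB-ℕ (suc n) = SCFB-⊕ SCFB-one (SCFB-ℕ n)

  δⁿ : ∀ n → Tm n (n + n)
  δⁿ n = SCFB.D (SCFB-ℕ n)

  εⁿ : ∀ n → Tm n 0
  εⁿ n = SCFB.E (SCFB-ℕ n)

  abstract
    εⁿ≡εₙ : ∀ n → εⁿ n ≡ εₙ n
    εⁿ≡εₙ zero    = refl
    εⁿ≡εₙ (suc n) = cong (ε ⊕_) (εⁿ≡εₙ n)

    εⁿ-sum : ∀ a b → εⁿ (a + b) ≅ (εⁿ a ⊕ εⁿ b)
    εⁿ-sum zero    b = ≅-sym (⊕-unitˡ≅ _)
    εⁿ-sum (suc a) b = ≅-trans (⊕≅ (≅-refl ε) (εⁿ-sum a b)) (≅-sym (⊕-assoc≅ _ _ _))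

    ε⁰≅I : εⁿ 0 ≅ I 0
    ε⁰≅I = ≅-refl id₀

    ε¹≅ε : εⁿ 1 ≅ ε
    ε¹≅ε = ⊕-unitʳ≅ ε

    ε²≅εε : εⁿ 2 ≅ (ε ⊕ ε)
    ε²≅εε = ⊕≅ (≅-refl ε) (⊕-unitʳ≅ ε)

    δⁿ≅δₙ : ∀ n → δⁿ n ≅ δₙ n
    δⁿ≅δₙ zero    = ≅-refl id₀
    δⁿ≅δₙ (suc n) =
      ≅-sym (≅-trans (cast≅ _ _ _)
        (⨾≅ (⊕≅ (≅-refl δ) (≅-sym (δⁿ≅δₙ n)))
            (≅-sym (≅-trans (τ≅middle 1 1 n n) (⊕≅ (≅-sym id₁≅I) (⊕≅ (σ-oneˡ n) (≅-refl (I n))))))))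

    δⁿ-sum : ∀ a b → δⁿ (a + b) ≅ ((δⁿ a ⊕ δⁿ b) ⨾ τ a a b b)
    δⁿ-sum zero b = ≅-sym (≅-trans (absorbʳ (τ-trivial′ b b) _) (⊕-unitˡ≅ _))
    δⁿ-sum (suc a) b = begin
        (δ ⊕ δⁿ (a + b)) ⨾ τ 1 1 (a + b) (a + b)
      ≅⟨ ⨾≅ (≅-trans (⊕≅ (≅-sym (idʳ≅ δ)) (δⁿ-sum a b)) (interchange≅ _ _ _ _)) (≅-refl _) ⟩
        ((δ ⊕ (δⁿ a ⊕ δⁿ b)) ⨾ (I 2 ⊕ τ a a b b)) ⨾ τ 1 1 (a + b) (a + b)
      ≅⟨ assoc≅ _ _ _ ⟩
        (δ ⊕ (δⁿ a ⊕ δⁿ b)) ⨾ ((I 2 ⊕ τ a a b b) ⨾ τ 1 1 (a + b) (a + b))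
      ≅⟨ ⨾≅ (≅-sym (⊕-assoc≅ _ _ _)) (τ-unzip-assoc 1 1 a a b b) ⟩
        ((δ ⊕ δⁿ a) ⊕ δⁿ b) ⨾ ((τ 1 1 a a ⊕ I (b + b)) ⨾ τ (1 + a) (1 + a) b b)
      ≅˘⟨ assoc≅ _ _ _ ⟩
        (((δ ⊕ δⁿ a) ⊕ δⁿ b) ⨾ (τ 1 1 a a ⊕ I (b + b))) ⨾ τ (1 + a) (1 + a) b b
      ≅˘⟨ ⨾≅ (interchange≅ _ _ _ _) (≅-refl _) ⟩
        (((δ ⊕ δⁿ a) ⨾ τ 1 1 a a) ⊕ (δⁿ b ⨾ I (b + b))) ⨾ τ (1 + a) (1 + a) b b
      ≅⟨ ⨾≅ (⊕≅ (≅-refl _) (idʳ≅ (δⁿ b))) (≅-refl _) ⟩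
        (δⁿ (suc a) ⊕ δⁿ b) ⨾ τ (suc a) (suc a) b b
      ∎

    δ⁰≅I : δⁿ 0 ≅ I 0
    δ⁰≅I = ≅-refl id₀

    δ¹≅δ : δⁿ 1 ≅ δ
    δ¹≅δ = ≅-trans (absorbʳ (≅-trans (τ≅middle 1 1 0 0) (middle-idlike 1 0 (σ-zeroʳ 1))) _) (⊕-unitʳ≅ δ)

    δ²≅ : δⁿ 2 ≅ ((δ ⊕ δ) ⨾ τ 1 1 1 1)
    δ²≅ = ⨾≅ (⊕≅ (≅-refl δ) δ¹≅δ) (≅-refl _)

  τ₁₁₁₁ : τ 1 1 1 1 ≅ middle 1 σ 1
  τ₁₁₁₁ = ≅-trans (τ≅middle 1 1 1 1) (⊕≅ (≅-refl (I 1)) (⊕≅ σ-one-one (≅-refl (I 1))))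

  δ⨾δδ : (δ ⨾ (δ ⊕ δ)) ≅ ((δ ⨾ (I 1 ⊕ δ)) ⨾ (I 1 ⊕ (δ ⊕ I 1)))
  δ⨾δδ = begin
      δ ⨾ (δ ⊕ δ)
    ≅⟨ ⨾≅ (≅-refl δ) (⊕-stagedˡ δ δ) ⟩
      δ ⨾ ((δ ⊕ I 1) ⨾ (I 2 ⊕ δ))
    ≅˘⟨ assoc≅ _ _ _ ⟩
      (δ ⨾ (δ ⊕ I 1)) ⨾ (I 2 ⊕ δ)
    ≅⟨ ⨾≅ (SCFB.D-assoc SCFB-one) (≅-trans (⊕≅ (I-split 1 1) (≅-refl δ)) (⊕-assoc≅ _ _ _)) ⟩
      (δ ⨾ (I 1 ⊕ δ)) ⨾ (I 1 ⊕ (I 1 ⊕ δ))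
    ≅⟨ assoc≅ _ _ _ ⟩
      δ ⨾ ((I 1 ⊕ δ) ⨾ (I 1 ⊕ (I 1 ⊕ δ)))
    ≅˘⟨ ⨾≅ (≅-refl δ) (I⊕-split 1 _ _) ⟩
      δ ⨾ (I 1 ⊕ (δ ⨾ (I 1 ⊕ δ)))
    ≅˘⟨ ⨾≅ (≅-refl δ) (⊕≅ (≅-refl (I 1)) (SCFB.D-assoc SCFB-one)) ⟩
      δ ⨾ (I 1 ⊕ (δ ⨾ (δ ⊕ I 1)))
    ≅⟨ ⨾≅ (≅-refl δ) (I⊕-split 1 _ _) ⟩
      δ ⨾ ((I 1 ⊕ δ) ⨾ (I 1 ⊕ (δ ⊕ I 1)))
    ≅˘⟨ assoc≅ _ _ _ ⟩
      (δ ⨾ (I 1 ⊕ δ)) ⨾ (I 1 ⊕ (δ ⊕ I 1))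
    ∎

  δ⨾εε : (δ ⨾ (ε ⊕ ε)) ≅ ε
  δ⨾εε = ≅-trans (⨾≅ (≅-refl δ) (⊕-stagedˡ ε ε))
           (≅-trans (≅-sym (assoc≅ _ _ _)) (≅-trans (absorbˡ (SCFB.D-unit SCFB-one) _) (⊕-unitˡ≅ ε)))

  ηη⨾μ : ((η ⊕ η) ⨾ μ) ≅ η
  ηη⨾μ = ≅-trans (⨾≅ (⊕-stagedʳ η η) (≅-refl μ))
           (≅-trans (assoc≅ _ _ _) (≅-trans (⨾≅ (⊕-unitˡ≅ η) (SCFB.M-unit SCFB-one)) (idʳ≅ η)))

  -- the Frobenius law with a crossing: by commutativity of μ
  μδ-twisted : (((I 1 ⊕ δ) ⨾ (σ ⊕ I 1)) ⨾ (I 1 ⊕ μ)) ≅ (μ ⨾ δ)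
  μδ-twisted = ≅-sym (begin
      μ ⨾ δ
    ≅˘⟨ ⨾≅ (axiom≅ μ-comm) (≅-refl δ) ⟩
      (σ ⨾ μ) ⨾ δ
    ≅⟨ assoc≅ _ _ _ ⟩
      σ ⨾ (μ ⨾ δ)
    ≅˘⟨ ⨾≅ (≅-refl σ) (axiom≅ frob₁) ⟩
      σ ⨾ ((δ ⊕ id₁) ⨾ (id₁ ⊕ μ))
    ≅˘⟨ assoc≅ _ _ _ ⟩
      (σ ⨾ (δ ⊕ id₁)) ⨾ (id₁ ⊕ μ)
    ≅˘⟨ ⨾≅ (≅-trans (σ-natural id₁ δ) (⨾≅ σ-one-one (≅-refl _))) (≅-refl _) ⟩
      ((id₁ ⊕ δ) ⨾ σₙₘ 1 2) ⨾ (id₁ ⊕ μ)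
    ≅⟨ ⨾≅ (⨾≅ (≅-refl _) (≅-trans (σ-oneˡ 2) (⨾≅ (≅-refl _) (⊕≅ (≅-refl id₁) σ₁ₙ-one)))) (≅-refl _) ⟩
      ((id₁ ⊕ δ) ⨾ ((σ ⊕ I 1) ⨾ (id₁ ⊕ σ))) ⨾ (id₁ ⊕ μ)
    ≅⟨ ≅-trans (⨾≅ (≅-sym (assoc≅ _ _ _)) (≅-refl _)) (assoc≅ _ _ _) ⟩
      ((id₁ ⊕ δ) ⨾ (σ ⊕ I 1)) ⨾ ((id₁ ⊕ σ) ⨾ (id₁ ⊕ μ))
    ≅˘⟨ ⨾≅ (≅-refl _) (id₁⊕-split _ _) ⟩
      ((id₁ ⊕ δ) ⨾ (σ ⊕ I 1)) ⨾ (id₁ ⊕ (σ ⨾ μ))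
    ≅⟨ ⨾≅ (⨾≅ (⊕≅ id₁≅I (≅-refl δ)) (≅-refl _)) (⊕≅ id₁≅I (axiom≅ μ-comm)) ⟩
      ((I 1 ⊕ δ) ⨾ (σ ⊕ I 1)) ⨾ (I 1 ⊕ μ)
    ∎)

  μ-δ² : ((δⁿ 2) ⨾ (μ ⊕ μ)) ≅ (μ ⨾ δ)
  μ-δ² = begin
      δⁿ 2 ⨾ (μ ⊕ μ)
    ≅⟨ ⨾≅ (≅-trans δ²≅ (⨾≅ (≅-trans (⊕-stagedˡ δ δ) (⨾≅ (≅-refl _) I1⊕-δ)) τ₁₁₁₁))
          (≅-trans (⊕-stagedʳ μ μ) (⨾≅ I1⊕-μ (≅-refl _))) ⟩
      (((δ ⊕ I 1) ⨾ (I 1 ⊕ (I 1 ⊕ δ))) ⨾ middle 1 σ 1) ⨾ ((I 1 ⊕ (I 1 ⊕ μ)) ⨾ (μ ⊕ I 1))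
    ≅⟨ ≅-trans (⨾≅ (assoc≅ _ _ _) (≅-refl _)) (regroup₄ _ _ _ _) ⟩
      (δ ⊕ I 1) ⨾ ((((I 1 ⊕ (I 1 ⊕ δ)) ⨾ middle 1 σ 1) ⨾ (I 1 ⊕ (I 1 ⊕ μ))) ⨾ (μ ⊕ I 1))
    ≅⟨ ⨾≅ (≅-refl _) (⨾≅ twisted (≅-refl _)) ⟩
      (δ ⊕ I 1) ⨾ ((I 1 ⊕ (μ ⨾ δ)) ⨾ (μ ⊕ I 1))
    ≅⟨ ⨾≅ (≅-refl _) (≅-trans (⨾≅ (I⊕-split 1 _ _) (≅-refl _)) (assoc≅ _ _ _)) ⟩
      (δ ⊕ I 1) ⨾ ((I 1 ⊕ μ) ⨾ ((I 1 ⊕ δ) ⨾ (μ ⊕ I 1)))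
    ≅⟨ ⨾≅ (≅-refl _) (⨾≅ (≅-refl _) (SCFB.frobeniusʳ SCFB-one)) ⟩
      (δ ⊕ I 1) ⨾ ((I 1 ⊕ μ) ⨾ (μ ⨾ δ))
    ≅˘⟨ ⨾≅ (≅-refl _) (≅-trans (≅-sym (assoc≅ _ _ _))
                          (≅-trans (⨾≅ (SCFB.M-assoc SCFB-one) (≅-refl δ)) (assoc≅ _ _ _))) ⟩
      (δ ⊕ I 1) ⨾ ((μ ⊕ I 1) ⨾ (μ ⨾ δ))
    ≅˘⟨ assoc≅ _ _ _ ⟩
      ((δ ⊕ I 1) ⨾ (μ ⊕ I 1)) ⨾ (μ ⨾ δ)
    ≅⟨ absorbˡ (⊕I-inverse 1 (SCFB.D⨾M≅I SCFB-one)) _ ⟩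
      μ ⨾ δ
    ∎
    where
      I1⊕-δ : (I 2 ⊕ δ) ≅ (I 1 ⊕ (I 1 ⊕ δ))
      I1⊕-δ = ≅-trans (⊕≅ (I-split 1 1) (≅-refl δ)) (⊕-assoc≅ _ _ _)
      I1⊕-μ : (I 2 ⊕ μ) ≅ (I 1 ⊕ (I 1 ⊕ μ))
      I1⊕-μ = ≅-trans (⊕≅ (I-split 1 1) (≅-refl μ)) (⊕-assoc≅ _ _ _)
      twisted : (((I 1 ⊕ (I 1 ⊕ δ)) ⨾ middle 1 σ 1) ⨾ (I 1 ⊕ (I 1 ⊕ μ))) ≅ (I 1 ⊕ (μ ⨾ δ))
      twisted = begin
          ((I 1 ⊕ (I 1 ⊕ δ)) ⨾ (I 1 ⊕ (σ ⊕ I 1))) ⨾ (I 1 ⊕ (I 1 ⊕ μ))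
        ≅˘⟨ ⨾≅ (I⊕-split 1 _ _) (≅-refl _) ⟩
          (I 1 ⊕ ((I 1 ⊕ δ) ⨾ (σ ⊕ I 1))) ⨾ (I 1 ⊕ (I 1 ⊕ μ))
        ≅˘⟨ I⊕-split 1 _ _ ⟩
          I 1 ⊕ (((I 1 ⊕ δ) ⨾ (σ ⊕ I 1)) ⨾ (I 1 ⊕ μ))
        ≅⟨ ⊕≅ (≅-refl (I 1)) μδ-twisted ⟩
          I 1 ⊕ (μ ⨾ δ)
        ∎

  δ-copy : (δ ⨾ δⁿ 2) ≅ (δⁿ 1 ⨾ (δ ⊕ δ))
  δ-copy = begin
      δ ⨾ δⁿ 2
    ≅⟨ ⨾≅ (≅-refl δ) δ²≅ ⟩
      δ ⨾ ((δ ⊕ δ) ⨾ τ 1 1 1 1)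
    ≅˘⟨ assoc≅ _ _ _ ⟩
      (δ ⨾ (δ ⊕ δ)) ⨾ τ 1 1 1 1
    ≅⟨ ⨾≅ δ⨾δδ τ₁₁₁₁ ⟩
      ((δ ⨾ (I 1 ⊕ δ)) ⨾ (I 1 ⊕ (δ ⊕ I 1))) ⨾ middle 1 σ 1
    ≅⟨ assoc≅ _ _ _ ⟩
      (δ ⨾ (I 1 ⊕ δ)) ⨾ ((I 1 ⊕ (δ ⊕ I 1)) ⨾ middle 1 σ 1)
    ≅⟨ ⨾≅ (≅-refl _) (≅-trans (middle-⨾ 1 δ σ 1) (⊕≅ (≅-refl (I 1)) (⊕≅ (axiom≅ δ-comm) (≅-refl (I 1))))) ⟩
      (δ ⨾ (I 1 ⊕ δ)) ⨾ (I 1 ⊕ (δ ⊕ I 1))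
    ≅˘⟨ δ⨾δδ ⟩
      δ ⨾ (δ ⊕ δ)
    ≅˘⟨ ⨾≅ δ¹≅δ (≅-refl _) ⟩
      δⁿ 1 ⨾ (δ ⊕ δ)
    ∎

  ε-copy : (ε ⨾ δⁿ 0) ≅ (δⁿ 1 ⨾ (ε ⊕ ε))
  ε-copy = ≅-trans (absorbʳ δ⁰≅I ε) (≅-sym (≅-trans (⨾≅ δ¹≅δ (≅-refl _)) δ⨾εε))

  μ-copy : (μ ⨾ δⁿ 1) ≅ (δⁿ 2 ⨾ (μ ⊕ μ))
  μ-copy = ≅-sym (≅-trans μ-δ² (⨾≅ (≅-refl μ) (≅-sym δ¹≅δ)))

  σ-copy : (σ ⨾ δⁿ 2) ≅ (δⁿ 2 ⨾ (σ ⊕ σ))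
  σ-copy = begin
      σ ⨾ δⁿ 2
    ≅⟨ ⨾≅ (≅-sym σ-one-one) δ²≅ ⟩
      σₙₘ 1 1 ⨾ ((δ ⊕ δ) ⨾ τ 1 1 1 1)
    ≅˘⟨ assoc≅ _ _ _ ⟩
      (σₙₘ 1 1 ⨾ (δ ⊕ δ)) ⨾ τ 1 1 1 1
    ≅˘⟨ ⨾≅ (σ-natural δ δ) (≅-refl _) ⟩
      ((δ ⊕ δ) ⨾ σₙₘ 2 2) ⨾ τ 1 1 1 1
    ≅⟨ assoc≅ _ _ _ ⟩
      (δ ⊕ δ) ⨾ (σₙₘ 2 2 ⨾ τ 1 1 1 1)
    ≅⟨ ⨾≅ (≅-refl _) (σ-τ 1 1 1 1) ⟩
      (δ ⊕ δ) ⨾ (τ 1 1 1 1 ⨾ (σₙₘ 1 1 ⊕ σₙₘ 1 1))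
    ≅˘⟨ assoc≅ _ _ _ ⟩
      ((δ ⊕ δ) ⨾ τ 1 1 1 1) ⨾ (σₙₘ 1 1 ⊕ σₙₘ 1 1)
    ≅˘⟨ ⨾≅ δ²≅ (⊕≅ (≅-sym σ-one-one) (≅-sym σ-one-one)) ⟩
      δⁿ 2 ⨾ (σ ⊕ σ)
    ∎

  η-copy : (η ⨾ δⁿ 1) ≲ (δⁿ 0 ⨾ (η ⊕ η))
  η-copy = begin≲
      η ⨾ δⁿ 1
    ≈⟨ ≅-trans (⨾≅ (≅-refl η) δ¹≅δ) (≅-sym (idʳ≅ _)) ⟩
      (η ⨾ δ) ⨾ I 2
    ≈⟨ ⨾≅ (≅-refl _) (I-split 1 1) ⟩
      (η ⨾ δ) ⨾ (I 1 ⊕ I 1)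
    ≤⟨ ⨾≲ (≲-refl _) (⊕≲ (SCFB.adj-E₁ SCFB-one) (SCFB.adj-E₁ SCFB-one)) ⟩
      (η ⨾ δ) ⨾ ((ε ⨾ η) ⊕ (ε ⨾ η))
    ≈⟨ ⨾≅ (≅-refl _) (interchange≅ _ _ _ _) ⟩
      (η ⨾ δ) ⨾ ((ε ⊕ ε) ⨾ (η ⊕ η))
    ≈˘⟨ assoc≅ _ _ _ ⟩
      ((η ⨾ δ) ⨾ (ε ⊕ ε)) ⨾ (η ⊕ η)
    ≈⟨ ⨾≅ (≅-trans (assoc≅ _ _ _) (⨾≅ (≅-refl η) δ⨾εε)) (≅-refl _) ⟩
      (η ⨾ ε) ⨾ (η ⊕ η)
    ≤⟨ ⨾≲ (SCFB.adj-E₂ SCFB-one) (≲-refl _) ⟩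
      id₀ ⨾ (η ⊕ η)
    ≈˘⟨ ⨾≅ δ⁰≅I (≅-refl _) ⟩
      δⁿ 0 ⨾ (η ⊕ η)
    ∎≲
    where open ≲-Reasoning

  lax-δ-term : ∀ {n m} (R : Tm n m) → (R ⨾ δⁿ m) ≲ (δⁿ n ⨾ (R ⊕ R))
  lax-δ-term δ   = proj₁ δ-copy
  lax-δ-term ε   = proj₁ ε-copy
  lax-δ-term μ   = proj₁ μ-copy
  lax-δ-term η   = η-copy
  lax-δ-term id₀ = proj₁ (idlike-unique (⨾-idlike (≅-refl id₀) δ⁰≅I) (⨾-idlike δ⁰≅I (⊕-unitˡ≅ id₀)))
  lax-δ-term id₁ = proj₁ (≅-trans (absorbˡ id₁≅I _) (≅-sym (absorbʳ (⊕-idlike id₁≅I id₁≅I) _)))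
  lax-δ-term σ   = proj₁ σ-copy
  lax-δ-term (gen {n} {m} R) = begin≲
      gen R ⨾ δⁿ m
    ≈⟨ ⨾≅ (≅-refl (gen R)) (δⁿ≅δₙ m) ⟩
      gen R ⨾ δₙ m
    ≤⟨ ≤⇒≲ (by-I (lax-δ R)) ⟩
      δₙ n ⨾ (gen R ⊕ gen R)
    ≈˘⟨ ⨾≅ (δⁿ≅δₙ n) (≅-refl _) ⟩
      δⁿ n ⨾ (gen R ⊕ gen R)
    ∎≲
    where open ≲-Reasoning
  lax-δ-term (_⨾_ {n} {z} {m} c d) = begin≲
      (c ⨾ d) ⨾ δⁿ m
    ≈⟨ assoc≅ _ _ _ ⟩
      c ⨾ (d ⨾ δⁿ m)
    ≤⟨ ⨾≲ (≲-refl c) (lax-δ-term d) ⟩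
      c ⨾ (δⁿ z ⨾ (d ⊕ d))
    ≈˘⟨ assoc≅ _ _ _ ⟩
      (c ⨾ δⁿ z) ⨾ (d ⊕ d)
    ≤⟨ ⨾≲ (lax-δ-term c) (≲-refl _) ⟩
      (δⁿ n ⨾ (c ⊕ c)) ⨾ (d ⊕ d)
    ≈⟨ assoc≅ _ _ _ ⟩
      δⁿ n ⨾ ((c ⊕ c) ⨾ (d ⊕ d))
    ≈˘⟨ ⨾≅ (≅-refl _) (interchange≅ _ _ _ _) ⟩
      δⁿ n ⨾ ((c ⨾ d) ⊕ (c ⨾ d))
    ∎≲
    where open ≲-Reasoning
  lax-δ-term (_⊕_ {n} {m} {p} {q} c d) = begin≲
      (c ⊕ d) ⨾ δⁿ (m + q)
    ≈⟨ ⨾≅ (≅-refl _) (δⁿ-sum m q) ⟩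
      (c ⊕ d) ⨾ ((δⁿ m ⊕ δⁿ q) ⨾ τ m m q q)
    ≈˘⟨ ≅-trans (⨾≅ (interchange≅ _ _ _ _) (≅-refl _)) (assoc≅ _ _ _) ⟩
      ((c ⨾ δⁿ m) ⊕ (d ⨾ δⁿ q)) ⨾ τ m m q q
    ≤⟨ ⨾≲ (⊕≲ (lax-δ-term c) (lax-δ-term d)) (≲-refl _) ⟩
      ((δⁿ n ⨾ (c ⊕ c)) ⊕ (δⁿ p ⨾ (d ⊕ d))) ⨾ τ m m q q
    ≈⟨ ≅-trans (⨾≅ (interchange≅ _ _ _ _) (≅-refl _)) (assoc≅ _ _ _) ⟩
      (δⁿ n ⊕ δⁿ p) ⨾ (((c ⊕ c) ⊕ (d ⊕ d)) ⨾ τ m m q q)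
    ≈⟨ ⨾≅ (≅-refl _) (τ-natural c c d d) ⟩
      (δⁿ n ⊕ δⁿ p) ⨾ (τ n n p p ⨾ ((c ⊕ d) ⊕ (c ⊕ d)))
    ≈˘⟨ ≅-trans (⨾≅ (δⁿ-sum n p) (≅-refl _)) (assoc≅ _ _ _) ⟩
      δⁿ (n + p) ⨾ ((c ⊕ d) ⊕ (c ⊕ d))
    ∎≲
    where open ≲-Reasoning

  μ-discard : (μ ⨾ εⁿ 1) ≲ εⁿ 2
  μ-discard = begin≲
      μ ⨾ εⁿ 1
    ≈⟨ ≅-trans (⨾≅ (≅-refl μ) ε¹≅ε) (≅-sym (idˡ≅ _)) ⟩
      I 2 ⨾ (μ ⨾ ε)
    ≈⟨ ⨾≅ (I-split 1 1) (≅-refl _) ⟩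
      (I 1 ⊕ I 1) ⨾ (μ ⨾ ε)
    ≤⟨ ⨾≲ (⊕≲ (SCFB.adj-E₁ SCFB-one) (SCFB.adj-E₁ SCFB-one)) (≲-refl _) ⟩
      ((ε ⨾ η) ⊕ (ε ⨾ η)) ⨾ (μ ⨾ ε)
    ≈⟨ ⨾≅ (interchange≅ _ _ _ _) (≅-refl _) ⟩
      ((ε ⊕ ε) ⨾ (η ⊕ η)) ⨾ (μ ⨾ ε)
    ≈⟨ ≅-trans (assoc≅ _ _ _) (⨾≅ (≅-refl _) (≅-trans (≅-sym (assoc≅ _ _ _)) (⨾≅ ηη⨾μ (≅-refl ε)))) ⟩
      (ε ⊕ ε) ⨾ (η ⨾ ε)
    ≤⟨ ⨾≲ (≲-refl _) (SCFB.adj-E₂ SCFB-one) ⟩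
      (ε ⊕ ε) ⨾ id₀
    ≈⟨ ≅-trans (idʳ≅ _) (≅-sym ε²≅εε) ⟩
      εⁿ 2
    ∎≲
    where open ≲-Reasoning

  lax-ε-term : ∀ {n m} (R : Tm n m) → (R ⨾ εⁿ m) ≲ εⁿ n
  lax-ε-term δ   = proj₁ (≅-trans (⨾≅ (≅-refl δ) ε²≅εε) (≅-trans δ⨾εε (≅-sym ε¹≅ε)))
  lax-ε-term ε   = proj₁ (≅-trans (absorbʳ ε⁰≅I ε) (≅-sym ε¹≅ε))
  lax-ε-term μ   = μ-discard
  lax-ε-term η   = ≲-trans (⨾≲ (≲-refl η) (proj₁ ε¹≅ε)) (≲-trans (SCFB.adj-E₂ SCFB-one) (proj₂ ε⁰≅I))
  lax-ε-term id₀ = proj₁ (idˡ≅ _)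
  lax-ε-term id₁ = proj₁ (absorbˡ id₁≅I _)
  lax-ε-term σ   = proj₁ (begin
      σ ⨾ εⁿ 2
    ≅⟨ ⨾≅ (≅-sym σ-one-one) ε²≅εε ⟩
      σₙₘ 1 1 ⨾ (ε ⊕ ε)
    ≅˘⟨ σ-natural ε ε ⟩
      (ε ⊕ ε) ⨾ σₙₘ 0 0
    ≅⟨ ≅-trans (absorbʳ (σ-zeroˡ 0) _) (≅-sym ε²≅εε) ⟩
      εⁿ 2
    ∎)
  lax-ε-term (gen {n} {m} R) rewrite εⁿ≡εₙ n | εⁿ≡εₙ m = ≤⇒≲ (by-I (lax-ε R))
  lax-ε-term (c ⨾ d) = ≲-trans (proj₁ (assoc≅ _ _ _)) (≲-trans (⨾≲ (≲-refl c) (lax-ε-term d)) (lax-ε-term c))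
  lax-ε-term (_⊕_ {n} {m} {p} {q} c d) =
    ≲-trans (⨾≲ (≲-refl _) (proj₁ (εⁿ-sum m q)))
      (≲-trans (proj₂ (interchange≅ _ _ _ _))
        (≲-trans (⊕≲ (lax-ε-term c) (lax-ε-term d)) (proj₂ (εⁿ-sum n p))))

-- The associator
-- and the unitors of CB_Σ are identities up to transport, so all the
-- monoidal coherence laws reduce to the identity-like calculus.
module CBLaws {S : Signature} where
  open Hetero {S}
  open Symmetry {S}
  open Frobenius {S}
  open LaxHomomorphism {S}
  open OrderedSMC (CB S) using (α; α⁻; ru; ru⁻)

  α≅I : ∀ X Y Z → α X Y Z ≅ I ((X + Y) + Z)
  α≅I X Y Z = cast≅ _ _ _

  α⁻≅I : ∀ X Y Z → α⁻ X Y Z ≅ I (X + (Y + Z))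
  α⁻≅I X Y Z = cast≅ _ _ _

  ru≅I : ∀ X → ru X ≅ I (X + 0)
  ru≅I X = cast≅ _ _ _

  ru⁻≅I : ∀ X → ru⁻ X ≅ I X
  ru⁻≅I X = cast≅ _ _ _

  -- naturality of the associator and unitors is strict associativity and unitality of ⊕
  α-nat≅ : ∀ {X Y Z X' Y' Z'} (f : Tm X X') (g : Tm Y Y') (h : Tm Z Z') →
           (((f ⊕ g) ⊕ h) ⨾ α X' Y' Z') ≅ (α X Y Z ⨾ (f ⊕ (g ⊕ h)))
  α-nat≅ {X} {Y} {Z} {X'} {Y'} {Z'} f g h =
    ≅-trans (absorbʳ (α≅I X' Y' Z') _) (≅-trans (⊕-assoc≅ f g h) (≅-sym (absorbˡ (α≅I X Y Z) _)))

  lu-nat≅ : ∀ {X Y} (f : Tm X Y) → ((I 0 ⊕ f) ⨾ I Y) ≅ (I X ⨾ f)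
  lu-nat≅ f = ≅-trans (idʳ≅ _) (≅-trans (⊕-unitˡ≅ f) (≅-sym (idˡ≅ f)))

  ru-nat≅ : ∀ {X Y} (f : Tm X Y) → ((f ⊕ I 0) ⨾ ru Y) ≅ (ru X ⨾ f)
  ru-nat≅ {X} {Y} f = ≅-trans (absorbʳ (ru≅I Y) _) (≅-trans (⊕-unitʳ≅ f) (≅-sym (absorbˡ (ru≅I X) f)))

  -- coherence laws: all structure maps involved are identity-like
  pentagon≅ : ∀ W X Y Z → ((α W X Y ⊕ I Z) ⨾ (α W (X + Y) Z ⨾ (I W ⊕ α X Y Z)))
                          ≅ (α (W + X) Y Z ⨾ α W X (Y + Z))
  pentagon≅ W X Y Z =
    idlike-unique (⨾-idlike (⊕-idlike (α≅I W X Y) (≅-refl (I Z)))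
                            (⨾-idlike (α≅I W (X + Y) Z) (⊕-idlike (≅-refl (I W)) (α≅I X Y Z))))
                  (⨾-idlike (α≅I (W + X) Y Z) (α≅I W X (Y + Z)))

  triangle≅ : ∀ X Y → (α X 0 Y ⨾ (I X ⊕ I Y)) ≅ (ru X ⊕ I Y)
  triangle≅ X Y = idlike-unique (⨾-idlike (α≅I X 0 Y) (⊕-id≅ X Y)) (⊕-idlike (ru≅I X) (≅-refl (I Y)))

  -- the hexagon law is σ-hexagonʳ up to the identity-like associators
  hexagon≅ : ∀ X Y Z → (α X Y Z ⨾ (σₙₘ X (Y + Z) ⨾ α Y Z X))
                       ≅ ((σₙₘ X Y ⊕ I Z) ⨾ (α Y X Z ⨾ (I Y ⊕ σₙₘ X Z)))
  hexagon≅ X Y Z =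
    ≅-trans (absorbˡ (α≅I X Y Z) _) (≅-trans (absorbʳ (α≅I Y Z X) _)
      (≅-trans (σ-hexagonʳ X Y Z) (⨾≅ (≅-refl _) (≅-trans (cast≅ _ _ _) (≅-sym (absorbˡ (α≅I Y X Z) _))))))

  μⁿ : ∀ n → Tm (n + n) n
  μⁿ n = SCFB.M (SCFB-ℕ n)

  ηⁿ : ∀ n → Tm 0 n
  ηⁿ n = SCFB.U (SCFB-ℕ n)

  δⁿ-assoc : ∀ X → (δⁿ X ⨾ ((δⁿ X ⊕ I X) ⨾ α X X X)) ≅ (δⁿ X ⨾ (I X ⊕ δⁿ X))
  δⁿ-assoc X = ≅-trans (⨾≅ (≅-refl _) (absorbʳ (α≅I X X X) _)) (SCFB.D-assoc (SCFB-ℕ X))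

  δⁿ-unit : ∀ X → (δⁿ X ⨾ ((εⁿ X ⊕ I X) ⨾ I X)) ≅ I X
  δⁿ-unit X = ≅-trans (⨾≅ (≅-refl _) (idʳ≅ _)) (SCFB.D-unit (SCFB-ℕ X))

  μⁿ-assoc : ∀ X → ((μⁿ X ⊕ I X) ⨾ μⁿ X) ≅ (α X X X ⨾ ((I X ⊕ μⁿ X) ⨾ μⁿ X))
  μⁿ-assoc X = ≅-trans (SCFB.M-assoc (SCFB-ℕ X)) (≅-sym (absorbˡ (α≅I X X X) _))

  frobeniusˡⁿ : ∀ X → ((δⁿ X ⊕ I X) ⨾ (α X X X ⨾ (I X ⊕ μⁿ X))) ≅ (μⁿ X ⨾ δⁿ X)
  frobeniusˡⁿ X = ≅-trans (⨾≅ (≅-refl _) (≅-trans (absorbˡ (α≅I X X X) _) (≅-sym (cast≅ _ _ _))))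
                    (SCFB.frobeniusˡ (SCFB-ℕ X))

  frobeniusʳⁿ : ∀ X → ((I X ⊕ δⁿ X) ⨾ (α⁻ X X X ⨾ (μⁿ X ⊕ I X))) ≅ (μⁿ X ⨾ δⁿ X)
  frobeniusʳⁿ X = ≅-trans (⨾≅ (≅-refl _) (≅-trans (absorbˡ (α⁻≅I X X X) _) (≅-sym (cast≅ _ _ _))))
                    (SCFB.frobeniusʳ (SCFB-ℕ X))

mainTheorem7 : (S : Signature) → IsCartesianBicategory (CB S)
mainTheorem7 S = record
  { ≤-refl = refl≤ ; ≤-trans = trans≤ ; ⨾-mono = ⨾-cong ; ⊗-mono = ⊕-cong
  ; idˡ = λ f → ≅⇒≈ (idˡ≅ f) ; idʳ = λ f → ≅⇒≈ (idʳ≅ f) ; assoc = λ f g h → ≅⇒≈ (assoc≅ f g h)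
  ; ⊗-id = λ X Y → ≅⇒≈ (⊕-id≅ X Y) ; ⊗-⨾ = λ f g f' g' → ≅⇒≈ (interchange≅ f g f' g')
  ; α-iso₁ = λ X Y Z → ≅⇒≈ (idlike-unique (⨾-idlike (α≅I X Y Z) (α⁻≅I X Y Z)) (≅-refl _))
  ; α-iso₂ = λ X Y Z → ≅⇒≈ (idlike-unique (⨾-idlike (α⁻≅I X Y Z) (α≅I X Y Z)) (≅-refl _))
  ; α-nat = λ f g h → ≅⇒≈ (α-nat≅ f g h)
  ; lu-iso₁ = λ X → ≅⇒≈ (idˡ≅ _) ; lu-iso₂ = λ X → ≅⇒≈ (idˡ≅ _) ; lu-nat = λ f → ≅⇒≈ (lu-nat≅ f)
  ; ru-iso₁ = λ X → ≅⇒≈ (idlike-unique (⨾-idlike (ru≅I X) (ru⁻≅I X)) (≅-refl _))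
  ; ru-iso₂ = λ X → ≅⇒≈ (idlike-unique (⨾-idlike (ru⁻≅I X) (ru≅I X)) (≅-refl _))
  ; ru-nat = λ f → ≅⇒≈ (ru-nat≅ f)
  ; pentagon = λ W X Y Z → ≅⇒≈ (pentagon≅ W X Y Z) ; triangle = λ X Y → ≅⇒≈ (triangle≅ X Y)
  ; σ-nat = λ f g → ≅⇒≈ (σ-natural f g) ; σ-inv = λ X Y → ≅⇒≈ (σ-inverse X Y)
  ; hexagon = λ X Y Z → ≅⇒≈ (hexagon≅ X Y Z)
  ; δ = δⁿ ; ε = εⁿ ; μ = μⁿ ; η = ηⁿ
  ; δ-assoc = λ X → ≅⇒≈ (δⁿ-assoc X) ; δ-unit = λ X → ≅⇒≈ (δⁿ-unit X)
  ; δ-comm = λ X → ≅⇒≈ (SCFB.D-comm (SCFB-ℕ X))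
  ; μ-assoc = λ X → ≅⇒≈ (μⁿ-assoc X) ; μ-unit = λ X → ≅⇒≈ (SCFB.M-unit (SCFB-ℕ X))
  ; μ-comm = λ X → ≅⇒≈ (SCFB.M-comm (SCFB-ℕ X))
  ; frob₁ = λ X → ≅⇒≈ (frobeniusˡⁿ X) ; frob₂ = λ X → ≅⇒≈ (≅-sym (frobeniusʳⁿ X))
  ; special = λ X → ≅⇒≈ (SCFB.D⨾M≅I (SCFB-ℕ X))
  ; adj-ε₁ = λ X → ≲⇒≤ (SCFB.adj-E₁ (SCFB-ℕ X)) ; adj-ε₂ = λ X → ≲⇒≤ (SCFB.adj-E₂ (SCFB-ℕ X))
  ; adj-δ₁ = λ X → ≲⇒≤ (proj₂ (SCFB.D⨾M≅I (SCFB-ℕ X))) ; adj-δ₂ = λ X → ≲⇒≤ (SCFB.adj-D₂ (SCFB-ℕ X))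
  ; lax-δ = λ R → ≲⇒≤ (lax-δ-term R) ; lax-ε = λ R → ≲⇒≤ (lax-ε-term R)
  }
  where
    open Hetero {S}
    open Symmetry {S}
    open Frobenius {S}
    open LaxHomomorphism {S}
    open CBLaws {S}
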